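{- Let $d,k,n$ be positive integers with $k\geq4$ and $d\geq k-1$. Write $q=\lfloor n/d\rfloor$ and $r=n\bmod d$. (1) If $n\leq d$, then $\mathrm{gp}^k_d(P_n\,\Box\,P_2)=2\min(n,k-2)$ if $1\leq n\leq 2k-4$, and $\mathrm{gp}^k_d(P_n\,\Box\,P_2)=2k-3$ if $n\geq 2k-3$. (2) If $n\geq d+1$ and $d<2k-3$, then $\mathrm{gp}^k_d(P_n\,\Box\,P_2)=(2k-4)q+2\min(r,k-2)$. (3) Suppose $n\geq d+1$ and $d\geq 2k-3$. (a) If $r\leq k-2$: if $r\leq q$ then $\mathrm{gp}^k_d(P_n\,\Box\,P_2)=(2k-3)q+r$; if $r>q$ then $\mathrm{gp}^k_d(P_n\,\Box\,P_2)=(2k-4)q+2r$. (b) If $k-2<r<2k-3$: if $2k-4-r\leq q$ then $\mathrm{gp}^k_d(P_n\,\Box\,P_2)=(2k-3)q+r$; if $2k-4-r>q$ then $\mathrm{gp}^k_d(P_n\,\Box\,P_2)=(2k-4)(q+1)$. (c) If $r\geq 2k-3$, then $\mathrm{gp}^k_d(P_n\,\Box\,P_2)=(2k-3)(q+1)$.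
   Context: $P_n\,\Box\,P_2$ is the grid with vertex set $\{1,\ldots,n\}\times\{1,2\}$, where $(i,j)$ and $(i',j')$ are adjacent iff either $j=j'$ and $|i-i'|=1$, or $i=i'$ and $j\neq j'$. For a graph $G$, a geodesic is a shortest path between two vertices; its length $\lambda(g)$ is its number of edges. For $d\ge1$, $k\ge2$, $S\subseteq V(G)$ is a $k$-general $d$-position set if every geodesic $g$ with $|S\cap V(g)|\geq k$ has $\lambda(g)>d$; $\mathrm{gp}^k_d(G)$ is the largest cardinality of such a set. -}

module Defs where

open import Data.Nat using (ℕ; zero; suc; _+_; _*_; _∸_; _≤_; _<_)
open import Data.Fin using (Fin; toℕ)
import Data.Fin.Properties as FinP
open import Data.Product using (Σ; _×_; _,_; ∃; ∃-syntax)
open import Data.Product.Properties using (≡-dec)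
open import Data.Sum using (_⊎_)
open import Data.List using (List; []; _∷_; length; filter)
open import Data.List.Relation.Unary.Unique.Propositional using (Unique)
open import Relation.Binary.PropositionalEquality using (_≡_; _≢_)
open import Relation.Binary.Definitions using (DecidableEquality)

-- Vertices of P_n □ P_2 : (i , j) with i ∈ {0..n-1}, j ∈ {0,1}
-- (0-indexed version of {1..n} × {1,2}).
Vertex : ℕ → Set
Vertex n = Fin n × Fin 2

_≟V_ : ∀ {n} → DecidableEquality (Vertex n)
_≟V_ = ≡-dec FinP._≟_ FinP._≟_

Adj : ∀ {n} → Vertex n → Vertex n → Set
Adj (i , j) (i′ , j′) =
  (j ≡ j′ × (suc (toℕ i) ≡ toℕ i′ ⊎ suc (toℕ i′) ≡ toℕ i))
  ⊎ (i ≡ i′ × j ≢ j′)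

data Walk {n : ℕ} : Vertex n → Vertex n → List (Vertex n) → Set where
  here : ∀ {v} → Walk v v (v ∷ [])
  step : ∀ {u w v p} → Adj u w → Walk w v p → Walk u v (u ∷ p)

edgeLength : ∀ {A : Set} → List A → ℕ
edgeLength p = length p ∸ 1

IsGeodesic : ∀ {n} → List (Vertex n) → Set
IsGeodesic {n} g = Σ (Vertex n) λ u → Σ (Vertex n) λ v →
  Walk u v g × (∀ p → Walk u v p → edgeLength g ≤ edgeLength p)

-- |S ∩ V(g)| for a duplicate-free list S
countOn : ∀ {n} → List (Vertex n) → List (Vertex n) → ℕ
countOn S g = length (filter (λ x → Data.List.Membership.DecPropositional._∈?_ _≟V_ x g) S)
  where import Data.List.Membership.DecPropositional

IsGenPos : ∀ {n} → ℕ → ℕ → List (Vertex n) → Set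
IsGenPos d k S = ∀ g → IsGeodesic g → k ≤ countOn S g → d < edgeLength g

GpEq : ℕ → ℕ → ℕ → ℕ → Set
GpEq d k n m =
  (Σ (List (Vertex n)) λ S → Unique S × IsGenPos d k S × length S ≡ m)
  × (∀ (S : List (Vertex n)) → Unique S → IsGenPos d k S → length S ≤ m)

-- Write k = K + 2. Geodesics of P_n □ P_2 are the L-shaped paths that run along one row and
-- switch rows at most once, so S is in k-general d-position exactly when every L-shaped path of
-- length at most d carries at most K + 1 points of S.
--
-- Let X i be the number of points in column i. For a window of m ≤ d columns and a
-- column t in it, the two L-shaped paths turning at t cover the window once and column t twice,
-- so the window holds at most 2K + 2 − X t points: at most 2K if some column is full, at most
-- 2K + 1 in any case, and at most m if no column is full. Cutting the n = qd + r columns into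
-- blocks of d gives at most q · 2K + 2 min(r, K) points when d ≤ 2K; when d > 2K an induction on
-- q gives at most the larger of q · 2K + 2 min(r, K) and q (2K + 1) + min(r, 2K + 1).
--
-- Mark the columns whose index modulo d is below m. Taking both vertices of the
-- marked columns for m = K, or the marked columns alternately in the two rows for m = 2K + 1,
-- gives sets attaining these values.

module Submission where

open import Function using (_∘_; id; _$_)
open import Data.Empty using (⊥-elim)
open import Data.Nat
open import Data.Nat.Properties
open import Data.Nat.DivMod
open import Data.Nat.ListAction using (sum)
open import Data.Nat.Tactic.RingSolver using (solve-∀)
open import Data.Fin using (Fin; toℕ; fromℕ<)
open import Data.Fin.Patterns using (0F; 1F)
import Data.Fin.Properties as Fin
open import Data.Product using (Σ; ∃; _×_; _,_)
open import Data.Sum using (_⊎_; inj₁; inj₂; [_,_])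
open import Data.List using (List; []; _∷_; length; _++_; map; filter; reverse; _∷ʳ_; tabulate; allFin; cartesianProduct)
open import Data.List.Properties using (length-++; unfold-reverse; length-reverse; filter-all; map-tabulate)
open import Data.List.Membership.Propositional using (_∈_)
open import Data.List.Membership.Propositional.Properties using (∈-++⁺ˡ; ∈-++⁺ʳ)
open import Data.List.Relation.Unary.Any using (here; there)
import Data.List.Relation.Unary.Any.Properties as Any
open import Data.List.Relation.Unary.All using (All; []; _∷_; universal)
open import Data.List.Relation.Unary.All.Properties using (all-filter)
open import Data.List.Relation.Unary.AllPairs using ([]; _∷_)
open import Data.List.Relation.Unary.Unique.Propositional using (Unique)
import Data.List.Relation.Unary.Unique.Propositional.Properties as Unique
open import Relation.Binary.PropositionalEquality hiding ([_])
open import Relation.Nullary using (¬_; Dec; yes; no)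
open import Relation.Nullary.Decidable using (_×-dec_; _⊎-dec_)
open import Relation.Unary using (Pred; Decidable)
open import Level using (0ℓ)
open import Algebra.Properties.CommutativeSemigroup +-commutativeSemigroup using () renaming (interchange to +-interchange)
open import Defs

sum< : (ℕ → ℕ) → ℕ → ℕ
sum< f zero    = 0
sum< f (suc m) = f 0 + sum< (f ∘ suc) m

sum<-cong : ∀ {f g} m → (∀ {t} → t < m → f t ≡ g t) → sum< f m ≡ sum< g m
sum<-cong zero    f≡g = refl
sum<-cong (suc m) f≡g = cong₂ _+_ (f≡g z<s) (sum<-cong m (f≡g ∘ s<s))

sum<-≤-* : ∀ {f} m c → (∀ {t} → t < m → f t ≤ c) → sum< f m ≤ m * c
sum<-≤-* zero    c f≤c = z≤n
sum<-≤-* (suc m) c f≤c = +-mono-≤ (f≤c z<s) (sum<-≤-* m c (f≤c ∘ s<s))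

sum<-zero : ∀ {f} m → (∀ {t} → t < m → f t ≡ 0) → sum< f m ≡ 0
sum<-zero zero    f≡0 = refl
sum<-zero (suc m) f≡0 = cong₂ _+_ (f≡0 z<s) (sum<-zero m (f≡0 ∘ s<s))

sum<-split : ∀ f m₁ m₂ → sum< f (m₁ + m₂) ≡ sum< f m₁ + sum< (λ t → f (m₁ + t)) m₂
sum<-split f zero     m₂ = refl
sum<-split f (suc m₁) m₂ =
  trans (cong (f 0 +_) (sum<-split (f ∘ suc) m₁ m₂)) (sym (+-assoc (f 0) _ _))

sum<-snoc : ∀ f m → sum< f (suc m) ≡ sum< f m + f m
sum<-snoc f zero    = +-comm (f 0) 0
sum<-snoc f (suc m) = trans (cong (f 0 +_) (sum<-snoc (f ∘ suc) m)) (sym (+-assoc (f 0) _ _))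

sum<-distrib-+ : ∀ f g m → sum< (λ t → f t + g t) m ≡ sum< f m + sum< g m
sum<-distrib-+ f g zero    = refl
sum<-distrib-+ f g (suc m) = begin
  f 0 + g 0 + sum< (λ t → f (suc t) + g (suc t)) m
    ≡⟨ cong (f 0 + g 0 +_) (sum<-distrib-+ (f ∘ suc) (g ∘ suc) m) ⟩
  f 0 + g 0 + (sum< (f ∘ suc) m + sum< (g ∘ suc) m)
    ≡⟨ +-interchange (f 0) (g 0) _ _ ⟩
  f 0 + sum< (f ∘ suc) m + (g 0 + sum< (g ∘ suc) m) ∎
  where open ≡-Reasoning

window : (ℕ → ℕ) → ℕ → ℕ → ℕ
window X a m = sum< (λ t → X (a + t)) m

window-split : ∀ X a m₁ m₂ → window X a (m₁ + m₂) ≡ window X a m₁ + window X (a + m₁) m₂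
window-split X a m₁ m₂ = trans (sum<-split (λ t → X (a + t)) m₁ m₂)
  (cong (window X a m₁ +_) (sum<-cong m₂ λ {t} _ → cong X (sym (+-assoc a m₁ t))))

window-suc : ∀ X a m → window X a (suc m) ≡ X a + window X (suc a) m
window-suc X a m = cong₂ _+_ (cong X (+-identityʳ a)) (sum<-cong m λ {t} _ → cong X (+-suc a t))

private variable
  P Q R P′ : Set

𝟙 : Dec P → ℕ
𝟙 (yes _) = 1
𝟙 (no _)  = 0

𝟙≤1 : (p : Dec P) → 𝟙 p ≤ 1
𝟙≤1 (yes _) = ≤-refl
𝟙≤1 (no _)  = z≤n

𝟙-yes : (p : Dec P) → P → 𝟙 p ≡ 1
𝟙-yes (yes _) _  = refl
𝟙-yes (no ¬p) pf = ⊥-elim (¬p pf)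

𝟙-no : (p : Dec P) → ¬ P → 𝟙 p ≡ 0
𝟙-no (yes pf) ¬p = ⊥-elim (¬p pf)
𝟙-no (no _)   _  = refl

𝟙-mono-≤ : (p : Dec P) (q : Dec Q) → (P → Q) → 𝟙 p ≤ 𝟙 q
𝟙-mono-≤ (yes pf) q P⇒Q = ≤-reflexive (sym (𝟙-yes q (P⇒Q pf)))
𝟙-mono-≤ (no _)   q _   = z≤n

𝟙-×-dec : (p : Dec P) (q : Dec Q) → 𝟙 (p ×-dec q) ≡ 𝟙 p * 𝟙 q
𝟙-×-dec (yes _) (yes _) = refl
𝟙-×-dec (yes _) (no _)  = refl
𝟙-×-dec (no _)  _       = refl

𝟙-⊎ : (p : Dec P) (q : Dec Q) (r : Dec R) → (R → P ⊎ Q) → (P ⊎ Q → R) → ¬ (P × Q) →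
      𝟙 p + 𝟙 q ≡ 𝟙 r
𝟙-⊎ (yes pf) (yes qf) r _ _ disjoint = ⊥-elim (disjoint (pf , qf))
𝟙-⊎ (yes pf) (no _)   r _ into _ = sym (𝟙-yes r (into (inj₁ pf)))
𝟙-⊎ (no _)   (yes qf) r _ into _ = sym (𝟙-yes r (into (inj₂ qf)))
𝟙-⊎ (no ¬p)  (no ¬q)  r from _ _ = sym (𝟙-no r ([ ¬p , ¬q ] ∘ from))

𝟙+𝟙≤𝟙+𝟙 : (p : Dec P) (p′ : Dec P′) (q : Dec Q) (r : Dec R) →
          (P → Q ⊎ R) → (P′ → Q × R) → 𝟙 p + 𝟙 p′ ≤ 𝟙 q + 𝟙 r
𝟙+𝟙≤𝟙+𝟙 p (yes p′f) q r _ both = let qf , rf = both p′f in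
  ≤-trans (+-monoˡ-≤ 1 (𝟙≤1 p)) (≤-reflexive (sym (cong₂ _+_ (𝟙-yes q qf) (𝟙-yes r rf))))
𝟙+𝟙≤𝟙+𝟙 (no _)  (no _) q r _ _ = z≤n
𝟙+𝟙≤𝟙+𝟙 (yes pf) (no _) q r one _ with one pf | q | r
... | _      | yes _ | _     = s≤s z≤n
... | _      | no _  | yes _ = s≤s z≤n
... | inj₁ qf | no ¬q | no _ = ⊥-elim (¬q qf)
... | inj₂ rf | no _  | no ¬r = ⊥-elim (¬r rf)

module _ {A : Set} where

  sum-map-mono-≤ : ∀ {f g : A → ℕ} xs → (∀ x → f x ≤ g x) → sum (map f xs) ≤ sum (map g xs)
  sum-map-mono-≤ []       f≤g = z≤n
  sum-map-mono-≤ (x ∷ xs) f≤g = +-mono-≤ (f≤g x) (sum-map-mono-≤ xs f≤g)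

  sum-map-cong : ∀ {f g : A → ℕ} xs → (∀ x → f x ≡ g x) → sum (map f xs) ≡ sum (map g xs)
  sum-map-cong []       f≡g = refl
  sum-map-cong (x ∷ xs) f≡g = cong₂ _+_ (f≡g x) (sum-map-cong xs f≡g)

  sum-map-distrib-+ : ∀ (f g : A → ℕ) xs → sum (map (λ x → f x + g x) xs) ≡ sum (map f xs) + sum (map g xs)
  sum-map-distrib-+ f g []       = refl
  sum-map-distrib-+ f g (x ∷ xs) = begin
    f x + g x + sum (map (λ x → f x + g x) xs)     ≡⟨ cong (f x + g x +_) (sum-map-distrib-+ f g xs) ⟩
    f x + g x + (sum (map f xs) + sum (map g xs))  ≡⟨ +-interchange (f x) (g x) _ _ ⟩
    f x + sum (map f xs) + (g x + sum (map g xs))  ∎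
    where open ≡-Reasoning

  sum<-sum-map : ∀ (g : ℕ → A → ℕ) m xs →
                 sum< (λ t → sum (map (g t) xs)) m ≡ sum (map (λ x → sum< (λ t → g t x) m) xs)
  sum<-sum-map g m []       = sum<-zero m λ _ → refl
  sum<-sum-map g m (x ∷ xs) = trans (sum<-distrib-+ (λ t → g t x) (λ t → sum (map (g t) xs)) m)
                                    (cong (sum< (λ t → g t x) m +_) (sum<-sum-map g m xs))

  module _ {P : Pred A 0ℓ} (P? : Decidable P) where

    length-filter≡sum-𝟙 : ∀ xs → length (filter P? xs) ≡ sum (map (𝟙 ∘ P?) xs)
    length-filter≡sum-𝟙 []       = refl
    length-filter≡sum-𝟙 (x ∷ xs) with P? x
    ... | yes _ = cong suc (length-filter≡sum-𝟙 xs)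
    ... | no _  = length-filter≡sum-𝟙 xs

    sum-map-filter : ∀ (f : A → ℕ) xs → sum (map f (filter P? xs)) ≡ sum (map (λ x → 𝟙 (P? x) * f x) xs)
    sum-map-filter f []       = refl
    sum-map-filter f (x ∷ xs) with P? x
    ... | yes _ = cong₂ _+_ (sym (+-identityʳ (f x))) (sum-map-filter f xs)
    ... | no _  = sum-map-filter f xs

  module _ {P Q : Pred A 0ℓ} (P? : Decidable P) (Q? : Decidable Q) where

    length-filter-mono-≤ : ∀ xs → (∀ {x} → P x → Q x) → length (filter P? xs) ≤ length (filter Q? xs)
    length-filter-mono-≤ xs P⊆Q = begin
      length (filter P? xs)    ≡⟨ length-filter≡sum-𝟙 P? xs ⟩
      sum (map (𝟙 ∘ P?) xs)    ≤⟨ sum-map-mono-≤ xs (λ x → 𝟙-mono-≤ (P? x) (Q? x) P⊆Q) ⟩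
      sum (map (𝟙 ∘ Q?) xs)    ≡⟨ length-filter≡sum-𝟙 Q? xs ⟨
      length (filter Q? xs)    ∎
      where open ≤-Reasoning

    length-filter-+-≤ : ∀ {R P′ : Pred A 0ℓ} (R? : Decidable R) (P′? : Decidable P′) → ∀ xs →
      (∀ {x} → P x → Q x ⊎ R x) → (∀ {x} → P′ x → Q x × R x) →
      length (filter P? xs) + length (filter P′? xs) ≤ length (filter Q? xs) + length (filter R? xs)
    length-filter-+-≤ R? P′? xs P⊆Q∪R P′⊆Q∩R = begin
      length (filter P? xs) + length (filter P′? xs)
        ≡⟨ cong₂ _+_ (length-filter≡sum-𝟙 P? xs) (length-filter≡sum-𝟙 P′? xs) ⟩
      sum (map (𝟙 ∘ P?) xs) + sum (map (𝟙 ∘ P′?) xs)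
        ≡⟨ sum-map-distrib-+ (𝟙 ∘ P?) (𝟙 ∘ P′?) xs ⟨
      sum (map (λ x → 𝟙 (P? x) + 𝟙 (P′? x)) xs)
        ≤⟨ sum-map-mono-≤ xs (λ x → 𝟙+𝟙≤𝟙+𝟙 (P? x) (P′? x) (Q? x) (R? x) P⊆Q∪R P′⊆Q∩R) ⟩
      sum (map (λ x → 𝟙 (Q? x) + 𝟙 (R? x)) xs)
        ≡⟨ sum-map-distrib-+ (𝟙 ∘ Q?) (𝟙 ∘ R?) xs ⟩
      sum (map (𝟙 ∘ Q?) xs) + sum (map (𝟙 ∘ R?) xs)
        ≡⟨ cong₂ _+_ (length-filter≡sum-𝟙 Q? xs) (length-filter≡sum-𝟙 R? xs) ⟨
      length (filter Q? xs) + length (filter R? xs) ∎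
      where open ≤-Reasoning

    length-filter-∪-≤ : ∀ {R : Pred A 0ℓ} (R? : Decidable R) xs → (∀ {x} → P x → Q x ⊎ R x) →
      length (filter P? xs) ≤ length (filter Q? xs) + length (filter R? xs)
    length-filter-∪-≤ R? xs P⊆Q∪R =
      ≤-trans (m≤m+n _ _) (length-filter-+-≤ R? (λ _ → no id) xs P⊆Q∪R λ ())

-- Window bounds for a column profile

≤2*-⊓ : ∀ {x} m K → x ≤ 2 * m → x ≤ 2 * K → x ≤ 2 * (m ⊓ K)
≤2*-⊓ m K x≤2m x≤2K = ≤-trans (⊓-glb x≤2m x≤2K) (≤-reflexive (sym (*-distribˡ-⊓ 2 m K)))

paired staggered : ℕ → ℕ → ℕ → ℕ
paired    K q r = q * (2 * K) + 2 * (r ⊓ K)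
staggered K q r = q * suc (2 * K) + r ⊓ suc (2 * K)

module WindowBounds (X : ℕ → ℕ) (n d K : ℕ)
  (X≤2 : ∀ i → X i ≤ 2)
  (window+column≤ : ∀ a m t → t < m → m ≤ d → a + m ≤ n → window X a m + X (a + t) ≤ 2 * suc K)
  where

  FullColumnIn : ℕ → ℕ → Set
  FullColumnIn a m = ∃ λ t → t < m × 2 ≤ X (a + t)

  fullColumnIn? : ∀ a m → Dec (FullColumnIn a m)
  fullColumnIn? a = anyUpTo? (λ t → 2 ≤? X (a + t))

  window≤2* : ∀ a m → window X a m ≤ 2 * m
  window≤2* a m = ≤-trans (sum<-≤-* m 2 λ {t} _ → X≤2 (a + t)) (≤-reflexive (*-comm m 2))

  window+heavy≤ : ∀ {a m t c} → t < m → m ≤ d → a + m ≤ n → c ≤ X (a + t) →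
                  window X a m + c ≤ 2 * suc K
  window+heavy≤ t<m m≤d a+m≤n c≤X = ≤-trans (+-monoʳ-≤ _ c≤X) (window+column≤ _ _ _ t<m m≤d a+m≤n)

  window-full : ∀ {a m} → m ≤ d → a + m ≤ n → FullColumnIn a m → window X a m ≤ 2 * (m ⊓ K)
  window-full {a} {m} m≤d a+m≤n (t , t<m , 2≤X) = ≤2*-⊓ m K (window≤2* a m) (+-cancelʳ-≤ 2 _ _ (begin
    window X a m + 2 ≤⟨ window+heavy≤ t<m m≤d a+m≤n 2≤X ⟩
    2 * suc K        ≡⟨ *-suc 2 K ⟩
    2 + 2 * K        ≡⟨ +-comm 2 (2 * K) ⟩
    2 * K + 2        ∎))
    where open ≤-Reasoning

  window-sparse : ∀ {a m} → ¬ FullColumnIn a m → window X a m ≤ m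
  window-sparse {a} {m} ¬full = ≤-trans
    (sum<-≤-* m 1 λ {t} t<m → ≤-pred (≰⇒> λ 2≤X → ¬full (t , t<m , 2≤X)))
    (≤-reflexive (*-identityʳ m))

  window≤2min : ∀ {a m} → m ≤ d → a + m ≤ n → m ≤ 2 * K → window X a m ≤ 2 * (m ⊓ K)
  window≤2min {a} {m} m≤d a+m≤n m≤2K with fullColumnIn? a m
  ... | yes full = window-full m≤d a+m≤n full
  ... | no ¬full = ≤2*-⊓ m K (≤-trans (window-sparse ¬full) (m≤n*m m 2)) (≤-trans (window-sparse ¬full) m≤2K)

  -- Any occupied column t gives window + 1 ≤ 2K + 2.
  window≤1+2K : ∀ {a m} → m ≤ d → a + m ≤ n → window X a m ≤ suc (2 * K)
  window≤1+2K {a} {m} m≤d a+m≤n with anyUpTo? (λ t → 1 ≤? X (a + t)) m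
  ... | yes (t , t<m , 1≤X) = +-cancelʳ-≤ 1 _ _
    (≤-trans (window+heavy≤ t<m m≤d a+m≤n 1≤X) (≤-reflexive (2*[1+K]≡1+2K+1 K)))
    where
    2*[1+K]≡1+2K+1 : ∀ K → 2 * suc K ≡ suc (2 * K) + 1
    2*[1+K]≡1+2K+1 = solve-∀
  ... | no ¬occupied = ≤-trans (≤-reflexive (sum<-zero m λ {t} t<m →
                         n<1⇒n≡0 (≰⇒> λ 1≤X → ¬occupied (t , t<m , 1≤X)))) z≤n

  window-blocks : ∀ {B} → (∀ {a} → a + d ≤ n → window X a d ≤ B) →
                  ∀ q {a} → a + q * d ≤ n → window X a (q * d) ≤ q * B
  window-blocks block zero    _ = z≤n
  window-blocks {B} block (suc q) {a} a+[1+q]d≤n = begin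
    window X a (d + q * d)                ≡⟨ window-split X a d (q * d) ⟩
    window X a d + window X (a + d) (q * d) ≤⟨ +-mono-≤ (block (≤-trans (m≤m+n (a + d) (q * d)) a+d+qd≤n))
                                                      (window-blocks block q a+d+qd≤n) ⟩
    B + q * B                             ∎
    where
    open ≤-Reasoning
    a+d+qd≤n : a + d + q * d ≤ n
    a+d+qd≤n = ≤-trans (≤-reflexive (+-assoc a d (q * d))) a+[1+q]d≤n

  window-qd+r-short : d ≤ 2 * K → ∀ q r {a} → r < d → a + (q * d + r) ≤ n →
                      window X a (q * d + r) ≤ paired K q r
  window-qd+r-short d≤2K q r {a} r<d a+qd+r≤n = begin
    window X a (q * d + r)                     ≡⟨ window-split X a (q * d) r ⟩
    window X a (q * d) + window X (a + q * d) r ≤⟨ +-mono-≤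
       (window-blocks block q (≤-trans (m≤m+n (a + q * d) r) a+qd+r≤n′))
       (window≤2min (<⇒≤ r<d) a+qd+r≤n′ (≤-trans (<⇒≤ r<d) d≤2K)) ⟩
    paired K q r                               ∎
    where
    open ≤-Reasoning
    a+qd+r≤n′ : a + q * d + r ≤ n
    a+qd+r≤n′ = ≤-trans (≤-reflexive (+-assoc a (q * d) r)) a+qd+r≤n
    block : ∀ {a} → a + d ≤ n → window X a d ≤ 2 * K
    block a+d≤n = ≤-trans (window≤2min ≤-refl a+d≤n d≤2K) (*-monoʳ-≤ 2 (m⊓n≤n d K))

  -- Induction on q: either the first block holds a full column, hence at most 2K points,
  -- or neither it nor its first r columns do.
  window-qd+r-long : suc (2 * K) ≤ d → ∀ q r {a} → r < d → a + (q * d + r) ≤ n →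
                     window X a (q * d + r) ≤ paired K q r ⊔ staggered K q r
  window-qd+r-long 1+2K≤d zero r {a} r<d a+r≤n with fullColumnIn? a r
  ... | yes full = ≤-trans (window-full (<⇒≤ r<d) a+r≤n full) (m≤m⊔n _ _)
  ... | no ¬full = ≤-trans (⊓-glb (window-sparse ¬full) (window≤1+2K (<⇒≤ r<d) a+r≤n)) (m≤n⊔m _ _)
  window-qd+r-long 1+2K≤d (suc q) r {a} r<d a+[1+q]d+r≤n with fullColumnIn? a d
  ... | yes full = begin
    window X a (suc q * d + r)                   ≡⟨ cong (window X a) (+-assoc d (q * d) r) ⟩
    window X a (d + (q * d + r))                 ≡⟨ window-split X a d (q * d + r) ⟩
    window X a d + window X (a + d) (q * d + r)   ≤⟨ +-mono-≤
       (≤-trans (window-full ≤-refl a+d≤n full) (*-monoʳ-≤ 2 (m⊓n≤n d K)))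
       (window-qd+r-long 1+2K≤d q r r<d a+d+[qd+r]≤n) ⟩
    2 * K + (paired K q r ⊔ staggered K q r)          ≡⟨ +-distribˡ-⊔ (2 * K) _ _ ⟩
    (2 * K + paired K q r) ⊔ (2 * K + staggered K q r) ≤⟨ ⊔-mono-≤
       (≤-reflexive (sym (+-assoc (2 * K) (q * (2 * K)) _)))
       (≤-trans (+-monoˡ-≤ _ (n≤1+n (2 * K))) (≤-reflexive (sym (+-assoc (suc (2 * K)) (q * suc (2 * K)) _)))) ⟩
    paired K (suc q) r ⊔ staggered K (suc q) r        ∎
    where
    open ≤-Reasoning
    a+d+[qd+r]≤n : a + d + (q * d + r) ≤ n
    a+d+[qd+r]≤n = ≤-trans (≤-reflexive (trans (+-assoc a d _) (cong (a +_) (sym (+-assoc d (q * d) r))))) a+[1+q]d+r≤n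
    a+d≤n : a + d ≤ n
    a+d≤n = ≤-trans (m≤m+n (a + d) _) a+d+[qd+r]≤n
  ... | no ¬full = begin
    window X a (suc q * d + r)                     ≡⟨ cong (window X a) (+-comm (suc q * d) r) ⟩
    window X a (r + suc q * d)                     ≡⟨ window-split X a r (suc q * d) ⟩
    window X a r + window X (a + r) (suc q * d)     ≤⟨ +-mono-≤
       (⊓-glb (window-sparse ¬full-prefix) (window≤1+2K (<⇒≤ r<d) (≤-trans (m≤m+n (a + r) _) a+r+[1+q]d≤n)))
       (window-blocks (window≤1+2K ≤-refl) (suc q) a+r+[1+q]d≤n) ⟩
    r ⊓ suc (2 * K) + suc q * suc (2 * K)           ≡⟨ +-comm (r ⊓ suc (2 * K)) _ ⟩
    staggered K (suc q) r                            ≤⟨ m≤n⊔m _ _ ⟩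
    paired K (suc q) r ⊔ staggered K (suc q) r          ∎
    where
    open ≤-Reasoning
    a+r+[1+q]d≤n : a + r + suc q * d ≤ n
    a+r+[1+q]d≤n = ≤-trans (≤-reflexive (trans (+-assoc a r _) (cong (a +_) (+-comm r (suc q * d))))) a+[1+q]d+r≤n
    ¬full-prefix : ¬ FullColumnIn a r
    ¬full-prefix (t , t<r , 2≤X) = ¬full (t , <-≤-trans t<r (<⇒≤ r<d) , 2≤X)

-- Geometry of the ladder

col : ∀ {n} → Vertex n → ℕ
col (i , _) = toℕ i

row : ∀ {n} → Vertex n → Fin 2
row (_ , j) = j

rowGap : Fin 2 → Fin 2 → ℕ
rowGap j j′ = ∣ toℕ j - toℕ j′ ∣

rowGap≤1 : ∀ j j′ → rowGap j j′ ≤ 1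
rowGap≤1 0F 0F = z≤n
rowGap≤1 0F 1F = ≤-refl
rowGap≤1 1F 0F = ≤-refl
rowGap≤1 1F 1F = z≤n

≢⇒rowGap≡1 : ∀ {j j′} → j ≢ j′ → rowGap j j′ ≡ 1
≢⇒rowGap≡1 {0F} {0F} j≢j′ = ⊥-elim (j≢j′ refl)
≢⇒rowGap≡1 {0F} {1F} _    = refl
≢⇒rowGap≡1 {1F} {0F} _    = refl
≢⇒rowGap≡1 {1F} {1F} j≢j′ = ⊥-elim (j≢j′ refl)

rowGap≡0⇒≡ : ∀ {j j′} → rowGap j j′ ≡ 0 → j ≡ j′
rowGap≡0⇒≡ = Fin.toℕ-injective ∘ ∣m-n∣≡0⇒m≡n

-- The graph distance of P_n □ P_2 is the Manhattan distance.
dist : ∀ {n} → Vertex n → Vertex n → ℕ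
dist u v = ∣ col u - col v ∣ + rowGap (row u) (row v)

dist-comm : ∀ {n} (u v : Vertex n) → dist u v ≡ dist v u
dist-comm u v = cong₂ _+_ (∣-∣-comm (col u) (col v)) (∣-∣-comm (toℕ (row u)) (toℕ (row v)))

dist-refl : ∀ {n} (u : Vertex n) → dist u u ≡ 0
dist-refl u = cong₂ _+_ (∣n-n∣≡0 (col u)) (∣n-n∣≡0 (toℕ (row u)))

∣m-1+m∣≡1 : ∀ m → ∣ m - suc m ∣ ≡ 1
∣m-1+m∣≡1 zero    = refl
∣m-1+m∣≡1 (suc m) = ∣m-1+m∣≡1 m

Adj-sym : ∀ {n} {u w : Vertex n} → Adj u w → Adj w u
Adj-sym (inj₁ (j≡j′ , inj₁ right)) = inj₁ (sym j≡j′ , inj₂ right)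
Adj-sym (inj₁ (j≡j′ , inj₂ left))  = inj₁ (sym j≡j′ , inj₁ left)
Adj-sym (inj₂ (i≡i′ , j≢j′))       = inj₂ (sym i≡i′ , j≢j′ ∘ sym)

Adj⇒dist≤ : ∀ {n} {u w : Vertex n} v → Adj u w → dist u v ≤ suc (dist w v)
Adj⇒dist≤ {u = i , j} {i′ , _} v (inj₁ (refl , move)) = +-monoˡ-≤ (rowGap j (row v)) (begin
  ∣ toℕ i - col v ∣                        ≤⟨ ∣-∣-triangle (toℕ i) (toℕ i′) (col v) ⟩
  ∣ toℕ i - toℕ i′ ∣ + ∣ toℕ i′ - col v ∣   ≡⟨ cong (_+ ∣ toℕ i′ - col v ∣) (∣i-i′∣≡1 move) ⟩
  suc ∣ toℕ i′ - col v ∣                   ∎)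
  where
  open ≤-Reasoning
  ∣i-i′∣≡1 : suc (toℕ i) ≡ toℕ i′ ⊎ suc (toℕ i′) ≡ toℕ i → ∣ toℕ i - toℕ i′ ∣ ≡ 1
  ∣i-i′∣≡1 (inj₁ 1+i≡i′) = subst (λ x → ∣ toℕ i - x ∣ ≡ 1) 1+i≡i′ (∣m-1+m∣≡1 (toℕ i))
  ∣i-i′∣≡1 (inj₂ 1+i′≡i) = subst (λ x → ∣ x - toℕ i′ ∣ ≡ 1) 1+i′≡i
                              (trans (∣-∣-comm (suc (toℕ i′)) (toℕ i′)) (∣m-1+m∣≡1 (toℕ i′)))
Adj⇒dist≤ {u = i , j} {_ , j′} v (inj₂ (refl , _)) = begin
  ∣ toℕ i - col v ∣ + rowGap j (row v)
    ≤⟨ +-monoʳ-≤ ∣ toℕ i - col v ∣ (≤-trans (rowGap≤1 j (row v)) (s≤s z≤n)) ⟩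
  ∣ toℕ i - col v ∣ + suc (rowGap j′ (row v))
    ≡⟨ +-suc ∣ toℕ i - col v ∣ _ ⟩
  suc (∣ toℕ i - col v ∣ + rowGap j′ (row v)) ∎
  where open ≤-Reasoning

walk-length : ∀ {n} {u v : Vertex n} {p} → Walk u v p → length p ≡ suc (edgeLength p)
walk-length here       = refl
walk-length (step _ _) = refl

Walk⇒dist≤ : ∀ {n} {u v : Vertex n} {p} → Walk u v p → dist u v ≤ edgeLength p
Walk⇒dist≤ {u = u} here = ≤-reflexive (dist-refl u)
Walk⇒dist≤ {u = u} {v} (step {w = w} {p = p} u~w w⇝v) = begin
  dist u v             ≤⟨ Adj⇒dist≤ v u~w ⟩
  suc (dist w v)       ≤⟨ s≤s (Walk⇒dist≤ w⇝v) ⟩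
  suc (edgeLength p)   ≡⟨ sym (walk-length w⇝v) ⟩
  edgeLength (u ∷ p)   ∎
  where open ≤-Reasoning

walk-∷ʳ : ∀ {n} {u w v : Vertex n} {p} → Walk u w p → Adj w v → Walk u v (p ∷ʳ v)
walk-∷ʳ here           w~v = step w~v here
walk-∷ʳ (step u~x x⇝w) w~v = step u~x (walk-∷ʳ x⇝w w~v)

walk-reverse : ∀ {n} {u v : Vertex n} {p} → Walk u v p → Walk v u (reverse p)
walk-reverse here = here
walk-reverse {u = u} (step {p = p} u~w w⇝v) =
  subst (Walk _ _) (sym (unfold-reverse u p)) (walk-∷ʳ (walk-reverse w⇝v) (Adj-sym u~w))

walk-++ : ∀ {n} {u w v : Vertex n} {p q} → Walk u w p → Walk w v (w ∷ q) → Walk u v (p ++ q)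
walk-++ here           w⇝v = w⇝v
walk-++ (step u~x x⇝w) w⇝v = step u~x (walk-++ x⇝w w⇝v)

rowWalk : ∀ {n} j (i i′ : Fin n) k → toℕ i + k ≡ toℕ i′ →
  Σ (List (Vertex n)) λ p → Walk (i , j) (i′ , j) p × length p ≡ suc k ×
    (∀ x → toℕ i ≤ toℕ x → toℕ x ≤ toℕ i′ → (x , j) ∈ p)
rowWalk j i i′ zero i+0≡i′ with Fin.toℕ-injective (trans (sym (+-identityʳ (toℕ i))) i+0≡i′)
... | refl = (i , j) ∷ [] , here , refl ,
             λ x i≤x x≤i → here (cong (_, j) (sym (Fin.toℕ-injective (≤-antisym i≤x x≤i))))
rowWalk {n} j i i′ (suc k) i+1+k≡i′ with rowWalk j next i′ k next+k≡i′
  where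
  1+i<n : suc (toℕ i) < n
  1+i<n = <-≤-trans (s≤s (≤-trans (m≤m+n (suc (toℕ i)) k) (≤-reflexive (trans (sym (+-suc (toℕ i) k)) i+1+k≡i′))))
                    (Fin.toℕ<n i′)
  next : Fin n
  next = fromℕ< 1+i<n
  next+k≡i′ : toℕ next + k ≡ toℕ i′
  next+k≡i′ = trans (cong (_+ k) (Fin.toℕ-fromℕ< 1+i<n)) (trans (sym (+-suc (toℕ i) k)) i+1+k≡i′)
... | p , walk , len , covers =
  (i , j) ∷ p , step (inj₁ (refl , inj₁ (sym (Fin.toℕ-fromℕ< _)))) walk , cong suc len , covers′
  where
  covers′ : ∀ x → toℕ i ≤ toℕ x → toℕ x ≤ toℕ i′ → (x , j) ∈ ((i , j) ∷ p)
  covers′ x i≤x x≤i′ with toℕ i ≟ toℕ x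
  ... | yes i≡x = here (cong (_, j) (Fin.toℕ-injective (sym i≡x)))
  ... | no  i≢x = there (covers x (≤-trans (≤-reflexive (Fin.toℕ-fromℕ< _)) (≤∧≢⇒< i≤x i≢x)) x≤i′)

rowWalk≤ : ∀ {n} j (i i′ : Fin n) → toℕ i ≤ toℕ i′ →
  Σ (List (Vertex n)) λ p → Walk (i , j) (i′ , j) p × length p ≡ suc (toℕ i′ ∸ toℕ i) ×
    (∀ x → toℕ i ≤ toℕ x → toℕ x ≤ toℕ i′ → (x , j) ∈ p)
rowWalk≤ j i i′ i≤i′ = rowWalk j i i′ (toℕ i′ ∸ toℕ i) (m+[n∸m]≡n i≤i′)

∣m-n∣≡n∸m : ∀ {m n} → m ≤ n → ∣ m - n ∣ ≡ n ∸ m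
∣m-n∣≡n∸m {m} {n} m≤n = trans (∣-∣-comm m n) (m≤n⇒∣n-m∣≡n∸m m≤n)

rightwardShortestWalk : ∀ {n} (u v : Vertex n) → col u ≤ col v →
  Σ (List (Vertex n)) λ p → Walk u v p × edgeLength p ≡ dist u v
rightwardShortestWalk (i , j) (i′ , j′) i≤i′ with j Fin.≟ j′ | rowWalk≤ j′ i i′ i≤i′
... | yes refl | p , walk , len , _ =
  p , walk , trans (cong (_∸ 1) len) (sym (trans (cong₂ _+_ (∣m-n∣≡n∸m i≤i′) (∣n-n∣≡0 (toℕ j))) (+-identityʳ _)))
... | no j≢j′  | p , walk , len , _ =
  (i , j) ∷ p , step (inj₂ (refl , j≢j′)) walk ,
  trans len (sym (trans (cong₂ _+_ (∣m-n∣≡n∸m i≤i′) (≢⇒rowGap≡1 j≢j′)) (+-comm _ 1)))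

shortestWalk : ∀ {n} (u v : Vertex n) → Σ (List (Vertex n)) λ p → Walk u v p × edgeLength p ≡ dist u v
shortestWalk u v with ≤-total (col u) (col v)
... | inj₁ u≤v = rightwardShortestWalk u v u≤v
... | inj₂ v≤u with rightwardShortestWalk v u v≤u
...   | p , walk , len = reverse p , walk-reverse walk ,
                         trans (cong (_∸ 1) (length-reverse p)) (trans len (dist-comm v u))

Segment : ∀ {n} → Fin 2 → ℕ → ℕ → Vertex n → Set
Segment j lo hi x = row x ≡ j × lo ≤ col x × col x ≤ hi

segment? : ∀ {n} j lo hi → Decidable (Segment {n} j lo hi)
segment? j lo hi x = row x Fin.≟ j ×-dec lo ≤? col x ×-dec col x ≤? hi

-- The L-shaped path along row j from column lo to c, then along row j′ from c to hi.
OnL : ∀ {n} → Fin 2 → ℕ → ℕ → ℕ → Fin 2 → Vertex n → Set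
OnL j lo c hi j′ x = Segment j lo c x ⊎ Segment j′ c hi x

onL? : ∀ {n} j lo c hi j′ → Decidable (OnL {n} j lo c hi j′)
onL? j lo c hi j′ x = segment? j lo c x ⊎-dec segment? j′ c hi x

∣m-o∣≡1+∣1+m-o∣⇒m<o : ∀ m o → ∣ m - o ∣ ≡ suc ∣ suc m - o ∣ → m < o
∣m-o∣≡1+∣1+m-o∣⇒m<o zero    (suc o) _  = z<s
∣m-o∣≡1+∣1+m-o∣⇒m<o (suc m) zero    eq = ⊥-elim (m≢1+n+m (suc m) {1} eq)
∣m-o∣≡1+∣1+m-o∣⇒m<o (suc m) (suc o) eq = s<s (∣m-o∣≡1+∣1+m-o∣⇒m<o m o eq)

∣1+m-o∣≡1+∣m-o∣⇒o≤m : ∀ m o → ∣ suc m - o ∣ ≡ suc ∣ m - o ∣ → o ≤ m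
∣1+m-o∣≡1+∣m-o∣⇒o≤m m       zero    _  = z≤n
∣1+m-o∣≡1+∣m-o∣⇒o≤m zero    (suc o) eq = ⊥-elim (m≢1+n+m o {1} eq)
∣1+m-o∣≡1+∣m-o∣⇒o≤m (suc m) (suc o) eq = s≤s (∣1+m-o∣≡1+∣m-o∣⇒o≤m m o eq)

-- A walk no longer than the distance of its ends moves right or switches rows at every step,
-- and it can switch rows only once.
tight⇒OnL : ∀ {n} {u v : Vertex n} {p} → Walk u v p → col u ≤ col v → edgeLength p ≤ dist u v →
  ∃ λ c → col u ≤ c × c ≤ col v × (∀ {x} → x ∈ p → OnL (row u) (col u) c (col v) (row v) x)
tight⇒OnL {u = u} here _ _ = col u , ≤-refl , ≤-refl , λ { (here refl) → inj₁ (refl , ≤-refl , ≤-refl) }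
tight⇒OnL {u = i , j} {v = i′ , j′} (step {w = iw , jw} {p = p} u~w w⇝v) i≤i′ tight = go u~w
  where
  suc-edgeLength≤ : suc (edgeLength p) ≤ dist (i , j) (i′ , j′)
  suc-edgeLength≤ = ≤-trans (≤-reflexive (sym (walk-length w⇝v))) tight

  dist-step : dist (i , j) (i′ , j′) ≡ suc (dist (iw , jw) (i′ , j′))
  dist-step = ≤-antisym (Adj⇒dist≤ _ u~w) (≤-trans (s≤s (Walk⇒dist≤ w⇝v)) suc-edgeLength≤)

  tight′ : edgeLength p ≤ dist (iw , jw) (i′ , j′)
  tight′ = ≤-pred (≤-trans suc-edgeLength≤ (≤-reflexive dist-step))

  go : Adj (i , j) (iw , jw) →
       ∃ λ c → toℕ i ≤ c × c ≤ toℕ i′ × (∀ {x} → x ∈ (i , j) ∷ p → OnL j (toℕ i) c (toℕ i′) j′ x)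
  go (inj₁ (refl , inj₁ 1+i≡iw)) with tight⇒OnL w⇝v iw≤i′ tight′
    where
    iw≤i′ : toℕ iw ≤ toℕ i′
    iw≤i′ = subst (_≤ toℕ i′) 1+i≡iw (∣m-o∣≡1+∣1+m-o∣⇒m<o (toℕ i) (toℕ i′)
              (subst (λ x → ∣ toℕ i - toℕ i′ ∣ ≡ suc ∣ x - toℕ i′ ∣) (sym 1+i≡iw)
                (+-cancelʳ-≡ (rowGap j j′) _ _ dist-step)))
  ... | c , iw≤c , c≤i′ , onL = c , i≤c , c≤i′ , λ
    { (here refl)  → inj₁ (refl , ≤-refl , i≤c)
    ; (there x∈p) → widen (onL x∈p) }
    where
    i≤iw : toℕ i ≤ toℕ iw
    i≤iw = ≤-trans (n≤1+n (toℕ i)) (≤-reflexive 1+i≡iw)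
    i≤c : toℕ i ≤ c
    i≤c = ≤-trans i≤iw iw≤c
    widen : ∀ {x} → OnL j (toℕ iw) c (toℕ i′) j′ x → OnL j (toℕ i) c (toℕ i′) j′ x
    widen (inj₁ (≡j , iw≤x , x≤c)) = inj₁ (≡j , ≤-trans i≤iw iw≤x , x≤c)
    widen (inj₂ onSecondLeg)       = inj₂ onSecondLeg
  go (inj₁ (refl , inj₂ 1+iw≡i)) = ⊥-elim (<-irrefl refl (≤-trans (s≤s i′≤iw) (≤-trans (≤-reflexive 1+iw≡i) i≤i′)))
    where
    i′≤iw : toℕ i′ ≤ toℕ iw
    i′≤iw = ∣1+m-o∣≡1+∣m-o∣⇒o≤m (toℕ iw) (toℕ i′)
              (subst (λ x → ∣ x - toℕ i′ ∣ ≡ suc ∣ toℕ iw - toℕ i′ ∣) (sym 1+iw≡i)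
                (+-cancelʳ-≡ (rowGap j j′) _ _ dist-step))
  go (inj₂ (refl , j≢jw)) with tight⇒OnL w⇝v i≤i′ tight′
  ... | c , i≤c , c≤i′ , onL = toℕ i , ≤-refl , i≤i′ , λ
    { (here refl)  → inj₁ (refl , ≤-refl , ≤-refl)
    ; (there x∈p) → secondLeg (onL x∈p) }
    where
    jw≡j′ : jw ≡ j′
    jw≡j′ = rowGap≡0⇒≡ (n≤0⇒n≡0 (≤-pred (≤-trans (≤-reflexive (sym gap-step)) (rowGap≤1 j j′))))
      where
      gap-step : rowGap j j′ ≡ suc (rowGap jw j′)
      gap-step = +-cancelˡ-≡ ∣ toℕ i - toℕ i′ ∣ _ _ (trans dist-step (sym (+-suc _ _)))
    secondLeg : ∀ {x} → OnL jw (toℕ i) c (toℕ i′) j′ x → OnL j (toℕ i) (toℕ i) (toℕ i′) j′ x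
    secondLeg (inj₁ (≡jw , i≤x , x≤c)) = inj₂ (trans ≡jw jw≡j′ , i≤x , ≤-trans x≤c c≤i′)
    secondLeg (inj₂ (≡j′ , c≤x , x≤i′)) = inj₂ (≡j′ , ≤-trans i≤c c≤x , x≤i′)

geodesic⇒OnL : ∀ {n} {g : List (Vertex n)} → IsGeodesic g →
  Σ (Vertex n) λ s → Σ (Vertex n) λ e → ∃ λ c → col s ≤ c × c ≤ col e × dist s e ≤ edgeLength g ×
    (∀ {x} → x ∈ g → OnL (row s) (col s) c (col e) (row e) x)
geodesic⇒OnL {g = g} (u , v , walk , minimal) with shortestWalk u v | ≤-total (col u) (col v)
... | p , shortest , len | inj₁ u≤v with tight⇒OnL walk u≤v (≤-trans (minimal p shortest) (≤-reflexive len))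
...   | c , u≤c , c≤v , onL = u , v , c , u≤c , c≤v , Walk⇒dist≤ walk , onL
geodesic⇒OnL {g = g} (u , v , walk , minimal) | p , shortest , len | inj₂ v≤u
  with tight⇒OnL (walk-reverse walk) v≤u tight
  where
  tight : edgeLength (reverse g) ≤ dist v u
  tight = begin
    edgeLength (reverse g) ≡⟨ cong (_∸ 1) (length-reverse g) ⟩
    edgeLength g           ≤⟨ minimal p shortest ⟩
    edgeLength p           ≡⟨ trans len (dist-comm u v) ⟩
    dist v u               ∎
    where open ≤-Reasoning
... | c , v≤c , c≤u , onL = v , u , c , v≤c , c≤u ,
      ≤-trans (≤-reflexive (dist-comm v u)) (Walk⇒dist≤ walk) , onL ∘ Any.reverse⁺

∸-+-∸ : ∀ {a c b} → a ≤ c → c ≤ b → (c ∸ a) + (b ∸ c) ≡ b ∸ a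
∸-+-∸ {a} {c} {b} a≤c c≤b = +-cancelˡ-≡ a _ _ (begin
  a + ((c ∸ a) + (b ∸ c)) ≡⟨ sym (+-assoc a (c ∸ a) (b ∸ c)) ⟩
  a + (c ∸ a) + (b ∸ c)   ≡⟨ cong (_+ (b ∸ c)) (m+[n∸m]≡n a≤c) ⟩
  c + (b ∸ c)             ≡⟨ m+[n∸m]≡n c≤b ⟩
  b                       ≡⟨ sym (m+[n∸m]≡n (≤-trans a≤c c≤b)) ⟩
  a + (b ∸ a)             ∎)
  where open ≡-Reasoning

lGeodesic : ∀ {n} {j j′} → j ≢ j′ → ∀ {lo c hi} → lo ≤ c → c ≤ hi → hi < n →
  Σ (List (Vertex n)) λ g → IsGeodesic g × edgeLength g ≡ suc (hi ∸ lo) × (∀ {x} → OnL j lo c hi j′ x → x ∈ g)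
lGeodesic {n} {j} {j′} j≢j′ lo≤c c≤hi hi<n =
  onFin (fromℕ< lo<n) (fromℕ< c<n) (fromℕ< hi<n) (Fin.toℕ-fromℕ< lo<n) (Fin.toℕ-fromℕ< c<n) (Fin.toℕ-fromℕ< hi<n) lo≤c c≤hi
  where
  c<n = ≤-<-trans c≤hi hi<n
  lo<n = ≤-<-trans lo≤c c<n
  onFin : ∀ (a m b : Fin n) {lo c hi} → toℕ a ≡ lo → toℕ m ≡ c → toℕ b ≡ hi → lo ≤ c → c ≤ hi →
    Σ (List (Vertex n)) λ g → IsGeodesic g × edgeLength g ≡ suc (hi ∸ lo) × (∀ {x} → OnL j lo c hi j′ x → x ∈ g)
  onFin a m b refl refl refl a≤m m≤b with rowWalk≤ j a m a≤m | rowWalk≤ j′ m b m≤b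
  ... | p₁ , walk₁ , len₁ , covers₁ | p₂ , walk₂ , len₂ , covers₂ =
    p₁ ++ p₂ , ((a , j) , (b , j′) , walk-++ walk₁ (step (inj₂ (refl , j≢j′)) walk₂) , minimal) , length≡ , covers
    where
    length≡ : edgeLength (p₁ ++ p₂) ≡ suc (toℕ b ∸ toℕ a)
    length≡ = begin
      length (p₁ ++ p₂) ∸ 1                    ≡⟨ cong (_∸ 1) (length-++ p₁) ⟩
      length p₁ + length p₂ ∸ 1                ≡⟨ cong₂ (λ x y → x + y ∸ 1) len₁ len₂ ⟩
      (toℕ m ∸ toℕ a) + suc (toℕ b ∸ toℕ m)    ≡⟨ +-suc _ _ ⟩
      suc ((toℕ m ∸ toℕ a) + (toℕ b ∸ toℕ m))  ≡⟨ cong suc (∸-+-∸ a≤m m≤b) ⟩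
      suc (toℕ b ∸ toℕ a)                      ∎
      where open ≡-Reasoning
    minimal : ∀ q → Walk (a , j) (b , j′) q → edgeLength (p₁ ++ p₂) ≤ edgeLength q
    minimal q walk = ≤-trans (≤-reflexive (trans length≡ (sym dist≡))) (Walk⇒dist≤ walk)
      where
      dist≡ : dist (a , j) (b , j′) ≡ suc (toℕ b ∸ toℕ a)
      dist≡ = trans (cong₂ _+_ (∣m-n∣≡n∸m (≤-trans a≤m m≤b)) (≢⇒rowGap≡1 j≢j′)) (+-comm _ 1)
    covers : ∀ {x} → OnL j (toℕ a) (toℕ m) (toℕ b) j′ x → x ∈ p₁ ++ p₂
    covers {x , _} (inj₁ (refl , a≤x , x≤m)) = ∈-++⁺ˡ (covers₁ x a≤x x≤m)
    covers {x , _} (inj₂ (refl , m≤x , x≤b)) = ∈-++⁺ʳ p₁ (covers₂ x m≤x x≤b)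

-- Upper bound

window-𝟙≟ : ∀ y a m → window (λ i → 𝟙 (y ≟ i)) a m ≡ 𝟙 (a ≤? y ×-dec y <? a + m)
window-𝟙≟ y a zero = sym (𝟙-no (a ≤? y ×-dec y <? a + 0) λ (a≤y , y<a+0) →
                        <⇒≱ y<a+0 (≤-trans (≤-reflexive (+-identityʳ a)) a≤y))
window-𝟙≟ y a (suc m) = begin
  window (λ i → 𝟙 (y ≟ i)) a (suc m)
    ≡⟨ sum<-snoc (λ t → 𝟙 (y ≟ a + t)) m ⟩
  window (λ i → 𝟙 (y ≟ i)) a m + 𝟙 (y ≟ a + m)
    ≡⟨ cong (_+ 𝟙 (y ≟ a + m)) (window-𝟙≟ y a m) ⟩
  𝟙 (a ≤? y ×-dec y <? a + m) + 𝟙 (y ≟ a + m)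
    ≡⟨ 𝟙-⊎ (a ≤? y ×-dec y <? a + m) (y ≟ a + m) (a ≤? y ×-dec y <? a + suc m) split join disjoint ⟩
  𝟙 (a ≤? y ×-dec y <? a + suc m) ∎
  where
  open ≡-Reasoning
  split : a ≤ y × y < a + suc m → (a ≤ y × y < a + m) ⊎ y ≡ a + m
  split (a≤y , y<a+1+m) with m≤n⇒m<n∨m≡n (≤-pred (≤-trans y<a+1+m (≤-reflexive (+-suc a m))))
  ... | inj₁ y<a+m = inj₁ (a≤y , y<a+m)
  ... | inj₂ y≡a+m = inj₂ y≡a+m
  join : (a ≤ y × y < a + m) ⊎ y ≡ a + m → a ≤ y × y < a + suc m
  join (inj₁ (a≤y , y<a+m)) = a≤y , <-≤-trans y<a+m (+-monoʳ-≤ a (n≤1+n m))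
  join (inj₂ refl)          = m≤m+n a m , ≤-reflexive (sym (+-suc a m))
  disjoint : ¬ ((a ≤ y × y < a + m) × y ≡ a + m)
  disjoint ((_ , y<a+m) , y≡a+m) = <⇒≢ y<a+m y≡a+m

columnCount : ∀ {n} → List (Vertex n) → ℕ → ℕ
columnCount S i = length (filter (λ x → col x ≟ i) S)

module _ {n : ℕ} (S : List (Vertex n)) where

  window-columnCount : ∀ a m →
    window (columnCount S) a m ≡ length (filter (λ x → a ≤? col x ×-dec col x <? a + m) S)
  window-columnCount a m = begin
    sum< (λ t → length (filter (λ x → col x ≟ a + t) S)) m
      ≡⟨ sum<-cong m (λ {t} _ → length-filter≡sum-𝟙 (λ x → col x ≟ a + t) S) ⟩
    sum< (λ t → sum (map (λ x → 𝟙 (col x ≟ a + t)) S)) m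
      ≡⟨ sum<-sum-map (λ t x → 𝟙 (col x ≟ a + t)) m S ⟩
    sum (map (λ x → window (λ i → 𝟙 (col x ≟ i)) a m) S)
      ≡⟨ sum-map-cong S (λ x → window-𝟙≟ (col x) a m) ⟩
    sum (map (λ x → 𝟙 (a ≤? col x ×-dec col x <? a + m)) S)
      ≡⟨ length-filter≡sum-𝟙 (λ x → a ≤? col x ×-dec col x <? a + m) S ⟨
    length (filter (λ x → a ≤? col x ×-dec col x <? a + m) S) ∎
    where open ≡-Reasoning

  length≡window-columnCount : length S ≡ window (columnCount S) 0 n
  length≡window-columnCount = sym (trans (window-columnCount 0 n)
    (cong length (filter-all _ (universal (λ (i , _) → z≤n , Fin.toℕ<n i) S))))

sameColumn-length≤2 : ∀ {n} {xs : List (Vertex n)} {i} → Unique xs → All (λ x → col x ≡ i) xs → length xs ≤ 2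
sameColumn-length≤2 {xs = []}                _ _ = z≤n
sameColumn-length≤2 {xs = _ ∷ []}            _ _ = s≤s z≤n
sameColumn-length≤2 {xs = _ ∷ _ ∷ []}        _ _ = s≤s (s≤s z≤n)
sameColumn-length≤2 {xs = (_ , j₁) ∷ (_ , j₂) ∷ (_ , j₃) ∷ _}
  ((x₁≢x₂ ∷ x₁≢x₃ ∷ _) ∷ (x₂≢x₃ ∷ _) ∷ _) (≡i₁ ∷ ≡i₂ ∷ ≡i₃ ∷ _) with rowPigeonhole j₁ j₂ j₃
  where
  rowPigeonhole : ∀ (j₁ j₂ j₃ : Fin 2) → j₁ ≡ j₂ ⊎ j₁ ≡ j₃ ⊎ j₂ ≡ j₃
  rowPigeonhole 0F 0F _  = inj₁ refl
  rowPigeonhole 1F 1F _  = inj₁ refl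
  rowPigeonhole 0F 1F 0F = inj₂ (inj₁ refl)
  rowPigeonhole 0F 1F 1F = inj₂ (inj₂ refl)
  rowPigeonhole 1F 0F 0F = inj₂ (inj₂ refl)
  rowPigeonhole 1F 0F 1F = inj₂ (inj₁ refl)
... | inj₁ j₁≡j₂        = ⊥-elim $ x₁≢x₂ (cong₂ _,_ (Fin.toℕ-injective (trans ≡i₁ (sym ≡i₂))) j₁≡j₂)
... | inj₂ (inj₁ j₁≡j₃) = ⊥-elim $ x₁≢x₃ (cong₂ _,_ (Fin.toℕ-injective (trans ≡i₁ (sym ≡i₃))) j₁≡j₃)
... | inj₂ (inj₂ j₂≡j₃) = ⊥-elim $ x₂≢x₃ (cong₂ _,_ (Fin.toℕ-injective (trans ≡i₂ (sym ≡i₃))) j₂≡j₃)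

columnCount≤2 : ∀ {n} {S : List (Vertex n)} → Unique S → ∀ i → columnCount S i ≤ 2
columnCount≤2 {S = S} unique i =
  sameColumn-length≤2 (Unique.filter⁺ (λ x → col x ≟ i) unique) (all-filter (λ x → col x ≟ i) S)

OnL-cover : ∀ {n lo c hi} (x : Vertex n) → lo ≤ col x → col x ≤ hi → OnL 0F lo c hi 1F x ⊎ OnL 1F lo c hi 0F x
OnL-cover {c = c} (i , 0F) lo≤x x≤hi with ≤-total (toℕ i) c
... | inj₁ x≤c = inj₁ (inj₁ (refl , lo≤x , x≤c))
... | inj₂ c≤x = inj₂ (inj₂ (refl , c≤x , x≤hi))
OnL-cover {c = c} (i , 1F) lo≤x x≤hi with ≤-total (toℕ i) c
... | inj₁ x≤c = inj₂ (inj₁ (refl , lo≤x , x≤c))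
... | inj₂ c≤x = inj₁ (inj₂ (refl , c≤x , x≤hi))

OnL-corner : ∀ {n lo c hi} (x : Vertex n) → lo ≤ c → c ≤ hi → col x ≡ c → OnL 0F lo c hi 1F x × OnL 1F lo c hi 0F x
OnL-corner (_ , 0F) lo≤c c≤hi refl = inj₁ (refl , lo≤c , ≤-refl) , inj₂ (refl , ≤-refl , c≤hi)
OnL-corner (_ , 1F) lo≤c c≤hi refl = inj₂ (refl , ≤-refl , c≤hi) , inj₁ (refl , lo≤c , ≤-refl)

module GeneralPosition {n : ℕ} (d K : ℕ) (S : List (Vertex n))
  (unique : Unique S) (genPos : IsGenPos d (suc (suc K)) S) where

  open import Data.List.Membership.DecPropositional (_≟V_ {n}) using (_∈?_)

  shortGeodesic-countOn≤ : ∀ {g} → IsGeodesic g → edgeLength g ≤ d → countOn S g ≤ suc K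
  shortGeodesic-countOn≤ {g} geodesic short with suc (suc K) ≤? countOn S g
  ... | yes crowded = ⊥-elim (<⇒≱ (genPos g geodesic crowded) short)
  ... | no ¬crowded = ≤-pred (≰⇒> ¬crowded)

  onShortGeodesic≤ : ∀ {j j′ lo c hi g} → (∀ {x} → OnL j lo c hi j′ x → x ∈ g) → IsGeodesic g →
                     edgeLength g ≤ d → length (filter (onL? j lo c hi j′) S) ≤ suc K
  onShortGeodesic≤ {j} {j′} {lo} {c} {hi} {g} covers geodesic short =
    ≤-trans (length-filter-mono-≤ (onL? j lo c hi j′) (_∈? g) S covers) (shortGeodesic-countOn≤ geodesic short)

  -- The two L-geodesics with corner column a + t cover the window once and that column twice.
  window+column≤ : ∀ a m t → t < m → m ≤ d → a + m ≤ n →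
                   window (columnCount S) a m + columnCount S (a + t) ≤ 2 * suc K
  window+column≤ a (suc m′) t (s≤s t≤m′) m≤d a+m≤n
    with lGeodesic {j = 0F} {1F} (λ ()) lo≤c c≤hi hi<n | lGeodesic {j = 1F} {0F} (λ ()) lo≤c c≤hi hi<n
    where
    lo≤c = m≤m+n a t
    c≤hi = +-monoʳ-≤ a t≤m′
    hi<n = ≤-trans (≤-reflexive (sym (+-suc a m′))) a+m≤n
  ... | g₁ , geodesic₁ , length₁ , covers₁ | g₂ , geodesic₂ , length₂ , covers₂ = begin
    window (columnCount S) a (suc m′) + columnCount S (a + t)
      ≡⟨ cong (_+ columnCount S (a + t)) (window-columnCount S a (suc m′)) ⟩
    length (filter inWindow? S) + columnCount S (a + t)
      ≤⟨ length-filter-+-≤ inWindow? L₁? L₂? (λ x → col x ≟ a + t) S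
           (λ {x} (a≤x , x<a+m) → OnL-cover x a≤x (≤-pred (≤-trans x<a+m (≤-reflexive (+-suc a m′)))))
           (λ {x} → OnL-corner x (m≤m+n a t) (+-monoʳ-≤ a t≤m′)) ⟩
    length (filter L₁? S) + length (filter L₂? S)
      ≤⟨ +-mono-≤ (onShortGeodesic≤ covers₁ geodesic₁ (short {g₁} length₁))
                  (onShortGeodesic≤ covers₂ geodesic₂ (short {g₂} length₂)) ⟩
    suc K + suc K
      ≡⟨ cong (suc K +_) (sym (+-identityʳ (suc K))) ⟩
    2 * suc K ∎
    where
    open ≤-Reasoning
    inWindow? = λ (x : Vertex n) → a ≤? col x ×-dec col x <? a + suc m′
    L₁? = onL? {n} 0F a (a + t) (a + m′) 1F
    L₂? = onL? {n} 1F a (a + t) (a + m′) 0F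
    short : ∀ {g : List (Vertex n)} → edgeLength g ≡ suc (a + m′ ∸ a) → edgeLength g ≤ d
    short len = ≤-trans (≤-reflexive (trans len (cong suc (m+n∸m≡n a m′)))) m≤d

  open WindowBounds (columnCount S) n d K (columnCount≤2 unique) window+column≤ public

-- Sets described by their row counts

sum<-restrict : ∀ (f : ℕ → ℕ) {lo hi N} → lo ≤ suc hi → suc hi ≤ N →
  sum< (λ y → 𝟙 (lo ≤? y ×-dec y ≤? hi) * f y) N ≡ window f lo (suc hi ∸ lo)
sum<-restrict f {lo} {hi} {N} lo≤1+hi 1+hi≤N = begin
  sum< g N                                              ≡⟨ cong (sum< g) N≡lo+[width+rest] ⟩
  sum< g (lo + (width + rest))                          ≡⟨ sum<-split g lo (width + rest) ⟩
  sum< g lo + window g lo (width + rest)                ≡⟨ cong₂ _+_ (sum<-zero lo below) (window-split g lo width rest) ⟩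
  0 + (window g lo width + window g (lo + width) rest)  ≡⟨ cong (window g lo width +_) (sum<-zero rest above) ⟩
  window g lo width + 0                                 ≡⟨ +-identityʳ _ ⟩
  window g lo width                                     ≡⟨ sum<-cong width inside ⟩
  window f lo width                                     ∎
  where
  open ≡-Reasoning
  g = λ y → 𝟙 (lo ≤? y ×-dec y ≤? hi) * f y
  width = suc hi ∸ lo
  rest = N ∸ suc hi
  lo+width≡1+hi : lo + width ≡ suc hi
  lo+width≡1+hi = m+[n∸m]≡n lo≤1+hi
  N≡lo+[width+rest] : N ≡ lo + (width + rest)
  N≡lo+[width+rest] = sym (trans (sym (+-assoc lo width rest)) (trans (cong (_+ rest) lo+width≡1+hi) (m+[n∸m]≡n 1+hi≤N)))
  outside : ∀ {y} → ¬ (lo ≤ y × y ≤ hi) → g y ≡ 0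
  outside {y} ¬range = cong (_* f y) (𝟙-no (lo ≤? y ×-dec y ≤? hi) ¬range)
  below : ∀ {t} → t < lo → g t ≡ 0
  below t<lo = outside λ (lo≤t , _) → <⇒≱ t<lo lo≤t
  above : ∀ {t} → t < rest → g (lo + width + t) ≡ 0
  above {t} _ = outside λ (_ , y≤hi) → <⇒≱ (≤-trans (≤-reflexive (sym lo+width≡1+hi)) (m≤m+n (lo + width) t)) y≤hi
  inside : ∀ {t} → t < width → g (lo + t) ≡ f (lo + t)
  inside {t} t<width = trans (cong (_* f (lo + t)) (𝟙-yes (lo ≤? lo + t ×-dec lo + t ≤? hi) (m≤m+n lo t , ≤-pred lo+t<1+hi)))
                         (+-identityʳ _)
    where
    lo+t<1+hi : lo + t < suc hi
    lo+t<1+hi = <-≤-trans (+-monoʳ-< lo t<width) (≤-reflexive lo+width≡1+hi)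

window-increments : ∀ (F : ℕ → ℕ) → (∀ x → F x ≤ F (suc x)) → ∀ lo M →
                    F lo + window (λ y → F (suc y) ∸ F y) lo M ≡ F (lo + M)
window-increments F F-mono lo zero    = trans (+-identityʳ (F lo)) (cong F (sym (+-identityʳ lo)))
window-increments F F-mono lo (suc M) = begin
  F lo + window Δ lo (suc M)            ≡⟨ cong (F lo +_) (sum<-snoc (λ t → Δ (lo + t)) M) ⟩
  F lo + (window Δ lo M + Δ (lo + M))   ≡⟨ +-assoc (F lo) _ _ ⟨
  F lo + window Δ lo M + Δ (lo + M)     ≡⟨ cong (_+ Δ (lo + M)) (window-increments F F-mono lo M) ⟩
  F (lo + M) + Δ (lo + M)               ≡⟨ m+[n∸m]≡n (F-mono (lo + M)) ⟩
  F (suc (lo + M))                      ≡⟨ cong F (+-suc lo M) ⟨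
  F (lo + suc M)                        ∎
  where
  open ≡-Reasoning
  Δ = λ y → F (suc y) ∸ F y

grid : ∀ n → List (Vertex n)
grid n = cartesianProduct (allFin n) (allFin 2)

sum-map-grid : ∀ {n} (f : Vertex n → ℕ) (g : ℕ → ℕ) → (∀ i → f (i , 0F) + f (i , 1F) ≡ g (toℕ i)) →
               sum (map f (grid n)) ≡ sum< g n
sum-map-grid {n} f g column = begin
  sum (map f (grid n))                                ≡⟨ byColumns (allFin n) ⟩
  sum (map (λ i → f (i , 0F) + f (i , 1F)) (allFin n)) ≡⟨ sum-map-cong (allFin n) column ⟩
  sum (map (g ∘ toℕ) (allFin n))                      ≡⟨ cong sum (map-tabulate {n = n} id (g ∘ toℕ)) ⟩
  sum (tabulate {n = n} (g ∘ toℕ))                    ≡⟨ sum-tabulate n g ⟩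
  sum< g n                                            ∎
  where
  open ≡-Reasoning
  byColumns : ∀ is → sum (map f (cartesianProduct is (allFin 2))) ≡ sum (map (λ i → f (i , 0F) + f (i , 1F)) is)
  byColumns []       = refl
  byColumns (i ∷ is) = begin
    sum (map f ((i , 0F) ∷ (i , 1F) ∷ cartesianProduct is (allFin 2)))
      ≡⟨ sym (+-assoc (f (i , 0F)) _ _) ⟩
    f (i , 0F) + f (i , 1F) + sum (map f (cartesianProduct is (allFin 2)))
      ≡⟨ cong (f (i , 0F) + f (i , 1F) +_) (byColumns is) ⟩
    f (i , 0F) + f (i , 1F) + sum (map (λ i → f (i , 0F) + f (i , 1F)) is) ∎
  sum-tabulate : ∀ m (g : ℕ → ℕ) → sum (tabulate {n = m} (g ∘ toℕ)) ≡ sum< g m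
  sum-tabulate zero    g = refl
  sum-tabulate (suc m) g = cong (g 0 +_) (sum-tabulate m (g ∘ suc))

-- F j x counts the points of the set in row j among the first x columns.
module Construction {n : ℕ} (d K : ℕ) (F : Fin 2 → ℕ → ℕ)
  (F-zero : ∀ j → F j 0 ≡ 0)
  (F-mono : ∀ j x → F j x ≤ F j (suc x))
  (F-step : ∀ j x → F j (suc x) ≤ suc (F j x))
  (segment≤ : ∀ j a b → b ≤ a + d → F j (suc b) ≤ F j a + suc K)
  (lShape≤ : ∀ {j j′} → j ≢ j′ → ∀ a c b → suc b ≤ a + d →
             F j (suc c) + F j′ (suc b) ≤ F j a + F j′ c + suc K)
  where

  increment : Fin 2 → ℕ → ℕ
  increment j y = F j (suc y) ∸ F j y

  chosen? : (x : Vertex n) → Dec (F (row x) (col x) < F (row x) (suc (col x)))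
  chosen? x = F (row x) (col x) <? F (row x) (suc (col x))

  S : List (Vertex n)
  S = filter chosen? (grid n)

  S-unique : Unique S
  S-unique = Unique.filter⁺ chosen? (Unique.cartesianProduct⁺ (Unique.allFin⁺ n) (Unique.allFin⁺ 2))

  𝟙-chosen : ∀ x → 𝟙 (chosen? x) ≡ increment (row x) (col x)
  𝟙-chosen (i , j) with chosen? (i , j)
  ... | yes F<F′ = sym (trans (cong (_∸ F j y) (≤-antisym (F-step j y) F<F′)) (m+n∸n≡m 1 (F j y)))
    where y = toℕ i
  ... | no  F≮F′ = sym (trans (cong (_∸ F j y) (≤-antisym (≮⇒≥ F≮F′) (F-mono j y))) (n∸n≡0 (F j y)))
    where y = toℕ i

  sum<-increment : ∀ j m → sum< (increment j) m ≡ F j m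
  sum<-increment j m = trans (cong (_+ sum< (increment j) m) (sym (F-zero j)))
                             (window-increments (F j) (F-mono j) 0 m)

  length-S : length S ≡ F 0F n + F 1F n
  length-S = begin
    length S                                              ≡⟨ length-filter≡sum-𝟙 chosen? (grid n) ⟩
    sum (map (𝟙 ∘ chosen?) (grid n))                      ≡⟨ sum-map-grid _ _ (λ i → cong₂ _+_ (𝟙-chosen (i , 0F))
                                                                                             (𝟙-chosen (i , 1F))) ⟩
    sum< (λ y → increment 0F y + increment 1F y) n        ≡⟨ sum<-distrib-+ (increment 0F) (increment 1F) n ⟩
    sum< (increment 0F) n + sum< (increment 1F) n         ≡⟨ cong₂ _+_ (sum<-increment 0F n) (sum<-increment 1F n) ⟩
    F 0F n + F 1F n                                       ∎
    where open ≡-Reasoning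

  weight : ∀ j lo hi x → 𝟙 (chosen? x) * 𝟙 (segment? j lo hi x)
                       ≡ increment (row x) (col x) * (𝟙 (row x Fin.≟ j) * 𝟙 (lo ≤? col x ×-dec col x ≤? hi))
  weight j lo hi x = cong₂ _*_ (𝟙-chosen x) (𝟙-×-dec (row x Fin.≟ j) (lo ≤? col x ×-dec col x ≤? hi))

  column-weight : ∀ j lo hi (i : Fin n) →
    𝟙 (chosen? (i , 0F)) * 𝟙 (segment? j lo hi (i , 0F)) + 𝟙 (chosen? (i , 1F)) * 𝟙 (segment? j lo hi (i , 1F))
      ≡ 𝟙 (lo ≤? toℕ i ×-dec toℕ i ≤? hi) * increment j (toℕ i)
  column-weight 0F lo hi i = trans (cong₂ _+_ (weight 0F lo hi (i , 0F)) (weight 0F lo hi (i , 1F)))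
                                   (rows (increment 0F (toℕ i)) (increment 1F (toℕ i)) (𝟙 (lo ≤? toℕ i ×-dec toℕ i ≤? hi)))
    where
    rows : ∀ a b ρ → a * (1 * ρ) + b * (0 * ρ) ≡ ρ * a
    rows = solve-∀
  column-weight 1F lo hi i = trans (cong₂ _+_ (weight 1F lo hi (i , 0F)) (weight 1F lo hi (i , 1F)))
                                   (rows (increment 0F (toℕ i)) (increment 1F (toℕ i)) (𝟙 (lo ≤? toℕ i ×-dec toℕ i ≤? hi)))
    where
    rows : ∀ a b ρ → a * (0 * ρ) + b * (1 * ρ) ≡ ρ * b
    rows = solve-∀

  segment-count : ∀ j {lo hi} → lo ≤ suc hi → suc hi ≤ n →
                  F j lo + length (filter (segment? j lo hi) S) ≡ F j (suc hi)
  segment-count j {lo} {hi} lo≤1+hi 1+hi≤n = begin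
    F j lo + length (filter seg? S)                ≡⟨ cong (F j lo +_) count≡window ⟩
    F j lo + window (increment j) lo (suc hi ∸ lo) ≡⟨ window-increments (F j) (F-mono j) lo _ ⟩
    F j (lo + (suc hi ∸ lo))                       ≡⟨ cong (F j) (m+[n∸m]≡n lo≤1+hi) ⟩
    F j (suc hi)                                   ∎
    where
    open ≡-Reasoning
    seg? = segment? {n} j lo hi
    count≡window : length (filter seg? S) ≡ window (increment j) lo (suc hi ∸ lo)
    count≡window = begin
      length (filter seg? S)                                     ≡⟨ length-filter≡sum-𝟙 seg? S ⟩
      sum (map (𝟙 ∘ seg?) (filter chosen? (grid n)))             ≡⟨ sum-map-filter chosen? (𝟙 ∘ seg?) (grid n) ⟩
      sum (map (λ x → 𝟙 (chosen? x) * 𝟙 (seg? x)) (grid n))     ≡⟨ sum-map-grid _ _ (column-weight j lo hi) ⟩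
      sum< (λ y → 𝟙 (lo ≤? y ×-dec y ≤? hi) * increment j y) n   ≡⟨ sum<-restrict (increment j) lo≤1+hi 1+hi≤n ⟩
      window (increment j) lo (suc hi ∸ lo)                      ∎

  private
    hi+g≤lo+d : ∀ {lo hi g} → lo ≤ hi → ∣ lo - hi ∣ + g ≤ d → hi + g ≤ lo + d
    hi+g≤lo+d {lo} {hi} {g} lo≤hi dist≤d = begin
      hi + g                 ≡⟨ cong (_+ g) (m+[n∸m]≡n lo≤hi) ⟨
      lo + (hi ∸ lo) + g     ≡⟨ +-assoc lo _ g ⟩
      lo + ((hi ∸ lo) + g)   ≤⟨ +-monoʳ-≤ lo (≤-trans (≤-reflexive (cong (_+ g) (sym (∣m-n∣≡n∸m lo≤hi)))) dist≤d) ⟩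
      lo + d                 ∎
      where open ≤-Reasoning

  OnL-count≤ : ∀ (s e : Vertex n) {c} → col s ≤ c → c ≤ col e → dist s e ≤ d →
               length (filter (onL? (row s) (col s) c (col e) (row e)) S) ≤ suc K
  OnL-count≤ (i , j) (i′ , j′) {c} lo≤c c≤hi dist≤d with j Fin.≟ j′
  ... | yes refl = +-cancelˡ-≤ (F j lo) _ _ (begin
    F j lo + length (filter (onL? j lo c hi j) S)   ≤⟨ +-monoʳ-≤ (F j lo) (length-filter-mono-≤ (onL? j lo c hi j) (segment? j lo hi) S
                                                        λ { (inj₁ (≡j , lo≤x , x≤c)) → ≡j , lo≤x , ≤-trans x≤c c≤hi
                                                          ; (inj₂ (≡j , c≤x , x≤hi)) → ≡j , ≤-trans lo≤c c≤x , x≤hi }) ⟩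
    F j lo + length (filter (segment? j lo hi) S)   ≡⟨ segment-count j (m≤n⇒m≤1+n lo≤hi) (Fin.toℕ<n i′) ⟩
    F j (suc hi)                                    ≤⟨ segment≤ j lo hi hi≤lo+d ⟩
    F j lo + suc K                                  ∎)
    where
    open ≤-Reasoning
    lo = toℕ i
    hi = toℕ i′
    lo≤hi = ≤-trans lo≤c c≤hi
    hi≤lo+d : hi ≤ lo + d
    hi≤lo+d = ≤-trans (≤-reflexive (sym (+-identityʳ hi)))
                      (hi+g≤lo+d lo≤hi (≤-trans (≤-reflexive (cong (∣ lo - hi ∣ +_) (sym (∣n-n∣≡0 (toℕ j))))) dist≤d))
  ... | no j≢j′ = +-cancelˡ-≤ (F j lo + F j′ c) _ _ (begin
    F j lo + F j′ c + length (filter (onL? j lo c hi j′) S)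
      ≤⟨ +-monoʳ-≤ (F j lo + F j′ c) (length-filter-∪-≤ (onL? j lo c hi j′) (segment? j lo c) (segment? j′ c hi) S id) ⟩
    F j lo + F j′ c + (length (filter (segment? j lo c) S) + length (filter (segment? j′ c hi) S))
      ≡⟨ +-interchange (F j lo) (F j′ c) (length (filter (segment? j lo c) S)) (length (filter (segment? j′ c hi) S)) ⟩
    (F j lo + length (filter (segment? j lo c) S)) + (F j′ c + length (filter (segment? j′ c hi) S))
      ≡⟨ cong₂ _+_ (segment-count j (m≤n⇒m≤1+n lo≤c) (<-≤-trans (s≤s c≤hi) (Fin.toℕ<n i′)))
                   (segment-count j′ (m≤n⇒m≤1+n c≤hi) (Fin.toℕ<n i′)) ⟩
    F j (suc c) + F j′ (suc hi)
      ≤⟨ lShape≤ j≢j′ lo c hi 1+hi≤lo+d ⟩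
    F j lo + F j′ c + suc K ∎)
    where
    open ≤-Reasoning
    lo = toℕ i
    hi = toℕ i′
    1+hi≤lo+d : suc hi ≤ lo + d
    1+hi≤lo+d = ≤-trans (≤-reflexive (+-comm 1 hi))
                        (hi+g≤lo+d (≤-trans lo≤c c≤hi) (≤-trans (≤-reflexive (cong (∣ lo - hi ∣ +_) (sym (≢⇒rowGap≡1 j≢j′)))) dist≤d))

  open import Data.List.Membership.DecPropositional (_≟V_ {n}) using (_∈?_)

  S-genPos : IsGenPos d (suc (suc K)) S
  S-genPos g geodesic crowded with d <? edgeLength g
  ... | yes long = long
  ... | no ¬long with geodesic⇒OnL geodesic
  ...   | s , e , c , s≤c , c≤e , dist≤length , onL = ⊥-elim (<⇒≱ crowded (begin
    countOn S g
      ≤⟨ length-filter-mono-≤ (_∈? g) (onL? (row s) (col s) c (col e) (row e)) S onL ⟩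
    length (filter (onL? (row s) (col s) c (col e) (row e)) S)
      ≤⟨ OnL-count≤ s e s≤c c≤e (≤-trans dist≤length (≮⇒≥ ¬long)) ⟩
    suc K ∎))
    where open ≤-Reasoning

-- Periodic marking and the two constructions

sum<-𝟙< : ∀ m r → sum< (λ t → 𝟙 (t <? m)) r ≡ r ⊓ m
sum<-𝟙< m zero    = refl
sum<-𝟙< m (suc r) = trans (sum<-snoc (λ t → 𝟙 (t <? m)) r) (trans (cong (_+ 𝟙 (r <? m)) (sum<-𝟙< m r)) (last (r <? m)))
  where
  last : (r<m : Dec (r < m)) → r ⊓ m + 𝟙 r<m ≡ suc r ⊓ m
  last (yes r<m) = trans (cong (_+ 1) (m≤n⇒m⊓n≡m (<⇒≤ r<m))) (trans (+-comm r 1) (sym (m≤n⇒m⊓n≡m r<m)))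
  last (no  r≮m) = trans (+-identityʳ _) (trans (m≥n⇒m⊓n≡n (≮⇒≥ r≮m)) (sym (m≥n⇒m⊓n≡n (m≤n⇒m≤1+n (≮⇒≥ r≮m)))))

module Periodic (d m : ℕ) .{{_ : NonZero d}} (m≤d : m ≤ d) where

  marked : ℕ → ℕ
  marked i = 𝟙 (i % d <? m)

  count : ℕ → ℕ
  count = sum< marked

  count-mono : ∀ x → count x ≤ count (suc x)
  count-mono x = ≤-trans (m≤m+n (count x) (marked x)) (≤-reflexive (sym (sum<-snoc marked x)))

  count-suc≤ : ∀ x → count (suc x) ≤ suc (count x)
  count-suc≤ x = ≤-trans (≤-reflexive (trans (sum<-snoc marked x) (+-comm (count x) (marked x))))
                         (+-monoˡ-≤ (count x) (𝟙≤1 (x % d <? m)))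

  count-mono-≤ : ∀ {x y} → x ≤ y → count x ≤ count y
  count-mono-≤ {x} {y} x≤y = begin
    count x                       ≤⟨ m≤m+n (count x) _ ⟩
    count x + window marked x (y ∸ x) ≡⟨ sum<-split marked x (y ∸ x) ⟨
    count (x + (y ∸ x))           ≡⟨ cong count (m+[n∸m]≡n x≤y) ⟩
    count y                       ∎
    where open ≤-Reasoning

  count-short : ∀ {r} → r ≤ d → count r ≡ r ⊓ m
  count-short {r} r≤d = trans (sum<-cong r λ t<r → cong (λ z → 𝟙 (z <? m)) (m<n⇒m%n≡m (<-≤-trans t<r r≤d)))
                              (sum<-𝟙< m r)

  window-marked : ∀ a → window marked a d ≡ m
  window-marked zero    = trans (count-short ≤-refl) (m≥n⇒m⊓n≡n m≤d)
  window-marked (suc a) = trans (+-cancelˡ-≡ (marked a) _ _ (begin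
    marked a + window marked (suc a) d   ≡⟨ window-suc marked a d ⟨
    window marked a (suc d)              ≡⟨ sum<-snoc (λ t → marked (a + t)) d ⟩
    window marked a d + marked (a + d)   ≡⟨ cong (λ z → window marked a d + 𝟙 (z <? m)) ([m+n]%n≡m%n a d) ⟩
    window marked a d + marked a         ≡⟨ +-comm _ (marked a) ⟩
    marked a + window marked a d         ∎)) (window-marked a)
    where open ≡-Reasoning

  count-+d : ∀ a → count (a + d) ≡ count a + m
  count-+d a = trans (sum<-split marked a d) (cong (count a +_) (window-marked a))

  count-blocks : ∀ r q → count (r + q * d) ≡ count r + q * m
  count-blocks r zero    = trans (cong count (+-identityʳ r)) (sym (+-identityʳ (count r)))
  count-blocks r (suc q) = begin
    count (r + (d + q * d))   ≡⟨ cong count (regroup r d (q * d)) ⟩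
    count (r + q * d + d)     ≡⟨ count-+d (r + q * d) ⟩
    count (r + q * d) + m     ≡⟨ cong (_+ m) (count-blocks r q) ⟩
    count r + q * m + m       ≡⟨ regroup′ (count r) (q * m) m ⟩
    count r + (m + q * m)     ∎
    where
    open ≡-Reasoning
    regroup : ∀ a b c → a + (b + c) ≡ a + c + b
    regroup = solve-∀
    regroup′ : ∀ a b c → a + b + c ≡ a + (c + b)
    regroup′ = solve-∀

  count-formula : ∀ x → count x ≡ x % d ⊓ m + (x / d) * m
  count-formula x = begin
    count x                        ≡⟨ cong count (m≡m%n+[m/n]*n x d) ⟩
    count (x % d + (x / d) * d)     ≡⟨ count-blocks (x % d) (x / d) ⟩
    count (x % d) + (x / d) * m     ≡⟨ cong (_+ (x / d) * m) (count-short (<⇒≤ (m%n<n x d))) ⟩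
    x % d ⊓ m + (x / d) * m         ∎
    where open ≡-Reasoning

  [x%d]⊓m+[x/d]*m≡x⊓m : ∀ {x} → x ≤ d → x % d ⊓ m + (x / d) * m ≡ x ⊓ m
  [x%d]⊓m+[x/d]*m≡x⊓m {x} x≤d = trans (sym (count-formula x)) (count-short x≤d)

  count-window≤ : ∀ {a y} → y ≤ a + d → count y ≤ count a + m
  count-window≤ {a} y≤a+d = ≤-trans (count-mono-≤ y≤a+d) (≤-reflexive (count-+d a))

  count-window-suc≤ : ∀ {a y} → y ≤ suc (a + d) → count y ≤ suc (count a + m)
  count-window-suc≤ {a} y≤1+a+d =
    ≤-trans (count-mono-≤ y≤1+a+d) (≤-trans (count-suc≤ (a + d)) (s≤s (≤-reflexive (count-+d a))))

Attains : ℕ → ℕ → ℕ → ℕ → Set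
Attains d k n m = Σ (List (Vertex n)) λ S → Unique S × IsGenPos d k S × length S ≡ m

-- Both rows of every marked column, K marked columns per period.
pairedSet : ∀ {n} d K .{{_ : NonZero d}} → K ≤ d → Attains d (suc (suc K)) n (2 * (n % d ⊓ K + (n / d) * K))
pairedSet {n} d K K≤d =
  S , S-unique , S-genPos ,
  trans length-S (trans (cong (count n +_) (sym (+-identityʳ (count n)))) (cong (2 *_) (count-formula n)))
  where
  open Periodic d K K≤d
  segment≤ : ∀ (j : Fin 2) a b → b ≤ a + d → count (suc b) ≤ count a + suc K
  segment≤ _ a b b≤a+d = ≤-trans (count-window-suc≤ (s≤s b≤a+d)) (≤-reflexive (sym (+-suc (count a) K)))
  lShape≤ : ∀ {j j′ : Fin 2} → j ≢ j′ → ∀ a c b → suc b ≤ a + d →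
            count (suc c) + count (suc b) ≤ count a + count c + suc K
  lShape≤ _ a c b 1+b≤a+d = ≤-trans (+-mono-≤ (count-suc≤ c) (count-window≤ 1+b≤a+d))
                                    (≤-reflexive (regroup (count a) (count c) K))
    where
    regroup : ∀ x y k → suc y + (x + k) ≡ x + y + suc k
    regroup = solve-∀
  open Construction {n} d K (λ _ → count) (λ _ → refl) (λ _ → count-mono) (λ _ → count-suc≤) segment≤ lShape≤

⌊m+2n/2⌋≡⌊m/2⌋+n : ∀ m n → ⌊ m + 2 * n /2⌋ ≡ ⌊ m /2⌋ + n
⌊m+2n/2⌋≡⌊m/2⌋+n m zero    = trans (cong ⌊_/2⌋ (+-identityʳ m)) (sym (+-identityʳ _))
⌊m+2n/2⌋≡⌊m/2⌋+n m (suc n) = begin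
  ⌊ m + 2 * suc n /2⌋          ≡⟨ cong ⌊_/2⌋ (two-more m n) ⟩
  suc ⌊ m + 2 * n /2⌋          ≡⟨ cong suc (⌊m+2n/2⌋≡⌊m/2⌋+n m n) ⟩
  suc (⌊ m /2⌋ + n)            ≡⟨ +-suc _ n ⟨
  ⌊ m /2⌋ + suc n              ∎
  where
  open ≡-Reasoning
  two-more : ∀ m n → m + 2 * suc n ≡ suc (suc (m + 2 * n))
  two-more = solve-∀

-- The marked columns, 2K + 1 per period, alternate between the two rows.
staggeredSet : ∀ {n} d K .{{_ : NonZero d}} → suc (2 * K) ≤ d →
               Attains d (suc (suc K)) n (n % d ⊓ suc (2 * K) + (n / d) * suc (2 * K))
staggeredSet {n} d K M≤d =
  S , S-unique , S-genPos ,
  trans length-S (trans (+-comm ⌈ count n /2⌉ _) (trans (⌊n/2⌋+⌈n/2⌉≡n (count n)) (count-formula n)))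
  where
  open Periodic d (suc (2 * K)) M≤d
  F : Fin 2 → ℕ → ℕ
  F 0F x = ⌈ count x /2⌉
  F 1F x = ⌊ count x /2⌋
  F-zero : ∀ j → F j 0 ≡ 0
  F-zero 0F = refl
  F-zero 1F = refl
  F-mono : ∀ j x → F j x ≤ F j (suc x)
  F-mono 0F x = ⌈n/2⌉-mono (count-mono x)
  F-mono 1F x = ⌊n/2⌋-mono (count-mono x)
  F-step : ∀ j x → F j (suc x) ≤ suc (F j x)
  F-step 0F x = ≤-trans (⌈n/2⌉-mono (count-suc≤ x)) (s≤s (⌊n/2⌋≤⌈n/2⌉ (count x)))
  F-step 1F x = ≤-trans (⌊n/2⌋-mono (count-suc≤ x)) (⌊n/2⌋-mono (n≤1+n (suc (count x))))
  regroup : ∀ x k → suc (x + suc (2 * k)) ≡ x + 2 * suc k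
  regroup = solve-∀
  long : ∀ {a y} → y ≤ suc (count a + suc (2 * K)) → y ≤ count a + 2 * suc K
  long {a} y≤ = ≤-trans y≤ (≤-reflexive (regroup (count a) K))
  segment≤ : ∀ j a b → b ≤ a + d → F j (suc b) ≤ F j a + suc K
  segment≤ 0F a b b≤a+d = ≤-trans (⌈n/2⌉-mono (long {a} (count-window-suc≤ (s≤s b≤a+d))))
                                  (≤-reflexive (⌊m+2n/2⌋≡⌊m/2⌋+n (suc (count a)) (suc K)))
  segment≤ 1F a b b≤a+d = ≤-trans (⌊n/2⌋-mono (long {a} (count-window-suc≤ (s≤s b≤a+d))))
                                  (≤-reflexive (⌊m+2n/2⌋≡⌊m/2⌋+n (count a) (suc K)))
  lShape≤ : ∀ {j j′} → j ≢ j′ → ∀ a c b → suc b ≤ a + d → F j (suc c) + F j′ (suc b) ≤ F j a + F j′ c + suc K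
  lShape≤ {0F} {0F} 0F≢0F = ⊥-elim (0F≢0F refl)
  lShape≤ {1F} {1F} 1F≢1F = ⊥-elim (1F≢1F refl)
  lShape≤ {0F} {1F} _ a c b 1+b≤a+d = ≤-trans
    (+-mono-≤ (⌈n/2⌉-mono (count-suc≤ c))
              (≤-trans (⌊n/2⌋-mono (≤-trans (count-window≤ 1+b≤a+d) (≤-reflexive (+-suc (count a) (2 * K)))))
                       (≤-reflexive (⌊m+2n/2⌋≡⌊m/2⌋+n (suc (count a)) K))))
    (≤-reflexive (regroup′ ⌈ count a /2⌉ ⌊ count c /2⌋ K))
    where
    regroup′ : ∀ x y k → suc y + (x + k) ≡ x + y + suc k
    regroup′ = solve-∀
  lShape≤ {1F} {0F} _ a c b 1+b≤a+d = ≤-trans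
    (+-mono-≤ (⌊n/2⌋-mono (count-suc≤ c))
              (≤-trans (⌈n/2⌉-mono (count-window≤ 1+b≤a+d))
                       (≤-reflexive (trans (cong ⌊_/2⌋ (regroup (count a) K)) (⌊m+2n/2⌋≡⌊m/2⌋+n (count a) (suc K))))))
    (≤-reflexive (regroup′ ⌊ count a /2⌋ ⌈ count c /2⌉ K))
    where
    regroup′ : ∀ x y k → y + (x + suc k) ≡ x + y + suc k
    regroup′ = solve-∀
  open Construction {n} d K F F-zero F-mono F-step segment≤ lShape≤

Attains-⊔ : ∀ {d k n a b} → Attains d k n a → Attains d k n b → Attains d k n (a ⊔ b)
Attains-⊔ {a = a} {b} attains-a attains-b with ⊔-sel a b
... | inj₁ a⊔b≡a = subst (Attains _ _ _) (sym a⊔b≡a) attains-a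
... | inj₂ a⊔b≡b = subst (Attains _ _ _) (sym a⊔b≡b) attains-b

module _ (d K n : ℕ) .{{_ : NonZero d}} (K≤d : K ≤ d) where

  private
    q = n / d
    r = n % d

    n≡qd+r : n ≡ q * d + r
    n≡qd+r = trans (m≡m%n+[m/n]*n n d) (+-comm r (q * d))

    length≡window-qd+r : ∀ (S : List (Vertex n)) → length S ≡ window (columnCount S) 0 (q * d + r)
    length≡window-qd+r S = trans (length≡window-columnCount S) (cong (window (columnCount S) 0) n≡qd+r)

  gp-short-small : n ≤ d → n ≤ 2 * K → GpEq d (suc (suc K)) n (2 * (n ⊓ K))
  gp-short-small n≤d n≤2K =
    subst (Attains d _ n) (cong (2 *_) (Periodic.[x%d]⊓m+[x/d]*m≡x⊓m d K K≤d n≤d)) (pairedSet d K K≤d) ,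
    λ S unique genPos → let open GeneralPosition d K S unique genPos in
      ≤-trans (≤-reflexive (length≡window-columnCount S)) (window≤2min {0} n≤d ≤-refl n≤2K)

  gp-short-large : n ≤ d → suc (2 * K) ≤ n → GpEq d (suc (suc K)) n (suc (2 * K))
  gp-short-large n≤d M≤n =
    subst (Attains d _ n) (trans (Periodic.[x%d]⊓m+[x/d]*m≡x⊓m d _ M≤d n≤d) (m≥n⇒m⊓n≡n M≤n)) (staggeredSet d K M≤d) ,
    λ S unique genPos → let open GeneralPosition d K S unique genPos in
      ≤-trans (≤-reflexive (length≡window-columnCount S)) (window≤1+2K {0} n≤d ≤-refl)
    where
    M≤d = ≤-trans M≤n n≤d

  gp-narrow : d ≤ 2 * K → GpEq d (suc (suc K)) n (2 * K * q + 2 * (r ⊓ K))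
  gp-narrow d≤2K =
    subst (Attains d _ n) (regroup (r ⊓ K) q K) (pairedSet d K K≤d) ,
    λ S unique genPos → let open GeneralPosition d K S unique genPos in
      ≤-trans (≤-reflexive (length≡window-qd+r S))
        (≤-trans (window-qd+r-short d≤2K q r {0} (m%n<n n d) (≤-reflexive (sym n≡qd+r)))
                 (≤-reflexive (cong (_+ 2 * (r ⊓ K)) (*-comm q (2 * K)))))
    where
    regroup : ∀ x q K → 2 * (x + q * K) ≡ 2 * K * q + 2 * x
    regroup = solve-∀

  gp-wide : suc (2 * K) ≤ d → GpEq d (suc (suc K)) n (paired K q r ⊔ staggered K q r)
  gp-wide M≤d =
    Attains-⊔ (subst (Attains d _ n) (regroup (r ⊓ K) q K) (pairedSet d K K≤d))
              (subst (Attains d _ n) (+-comm (r ⊓ suc (2 * K)) _) (staggeredSet d K M≤d)) ,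
    λ S unique genPos → let open GeneralPosition d K S unique genPos in
      ≤-trans (≤-reflexive (length≡window-qd+r S)) (window-qd+r-long M≤d q r {0} (m%n<n n d) (≤-reflexive (sym n≡qd+r)))
    where
    regroup : ∀ x q K → 2 * (x + q * K) ≡ q * (2 * K) + 2 * x
    regroup = solve-∀

module _ (K q r : ℕ) where

  private
    base = q * (2 * K)

    paired≡ : ∀ {x} → r ⊓ K ≡ x → paired K q r ≡ base + 2 * x
    paired≡ r⊓K≡x = cong (λ x → base + 2 * x) r⊓K≡x

    staggered≡ : ∀ {y} → r ⊓ suc (2 * K) ≡ y → staggered K q r ≡ base + (q + y)
    staggered≡ {y} r⊓M≡y = trans (cong (q * suc (2 * K) +_) r⊓M≡y) (regroup q K y)
      where
      regroup : ∀ q K y → q * suc (2 * K) + y ≡ q * (2 * K) + (q + y)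
      regroup = solve-∀

    ⊔-right : ∀ a {b c} → b ≤ c → a + b ⊔ (a + c) ≡ a + c
    ⊔-right a b≤c = m≤n⇒m⊔n≡n (+-monoʳ-≤ a b≤c)

    ⊔-left : ∀ a {b c} → c ≤ b → a + b ⊔ (a + c) ≡ a + b
    ⊔-left a c≤b = m≥n⇒m⊔n≡m (+-monoʳ-≤ a c≤b)

    r≤K⇒r≤M : r ≤ K → r ≤ suc (2 * K)
    r≤K⇒r≤M r≤K = ≤-trans r≤K (≤-trans (m≤m+n K (K + 0)) (n≤1+n _))

  max-r≤K-r≤q : r ≤ K → r ≤ q → paired K q r ⊔ staggered K q r ≡ suc (2 * K) * q + r
  max-r≤K-r≤q r≤K r≤q = begin
    paired K q r ⊔ staggered K q r      ≡⟨ cong₂ _⊔_ (paired≡ (m≤n⇒m⊓n≡m r≤K)) (staggered≡ (m≤n⇒m⊓n≡m (r≤K⇒r≤M r≤K))) ⟩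
    base + 2 * r ⊔ (base + (q + r))     ≡⟨ ⊔-right base (≤-trans (≤-reflexive (cong (r +_) (+-identityʳ r))) (+-monoˡ-≤ r r≤q)) ⟩
    base + (q + r)                       ≡⟨ regroup q K r ⟩
    suc (2 * K) * q + r                  ∎
    where
    open ≡-Reasoning
    regroup : ∀ q K r → q * (2 * K) + (q + r) ≡ suc (2 * K) * q + r
    regroup = solve-∀

  max-r≤K-q<r : r ≤ K → q < r → paired K q r ⊔ staggered K q r ≡ 2 * K * q + 2 * r
  max-r≤K-q<r r≤K q<r = begin
    paired K q r ⊔ staggered K q r      ≡⟨ cong₂ _⊔_ (paired≡ (m≤n⇒m⊓n≡m r≤K)) (staggered≡ (m≤n⇒m⊓n≡m (r≤K⇒r≤M r≤K))) ⟩
    base + 2 * r ⊔ (base + (q + r))     ≡⟨ ⊔-left base (≤-trans (+-monoˡ-≤ r (<⇒≤ q<r)) (≤-reflexive (cong (r +_) (sym (+-identityʳ r))))) ⟩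
    base + 2 * r                         ≡⟨ cong (_+ 2 * r) (*-comm q (2 * K)) ⟩
    2 * K * q + 2 * r                    ∎
    where open ≡-Reasoning

  max-K<r-2K∸r≤q : K < r → r < suc (2 * K) → 2 * K ∸ r ≤ q → paired K q r ⊔ staggered K q r ≡ suc (2 * K) * q + r
  max-K<r-2K∸r≤q K<r r<M 2K∸r≤q = begin
    paired K q r ⊔ staggered K q r      ≡⟨ cong₂ _⊔_ (paired≡ (m≥n⇒m⊓n≡n (<⇒≤ K<r))) (staggered≡ (m≤n⇒m⊓n≡m (<⇒≤ r<M))) ⟩
    base + 2 * K ⊔ (base + (q + r))     ≡⟨ ⊔-right base 2K≤q+r ⟩
    base + (q + r)                       ≡⟨ regroup q K r ⟩
    suc (2 * K) * q + r                  ∎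
    where
    open ≡-Reasoning
    regroup : ∀ q K r → q * (2 * K) + (q + r) ≡ suc (2 * K) * q + r
    regroup = solve-∀
    2K≤q+r : 2 * K ≤ q + r
    2K≤q+r = ≤-trans (m≤n+m∸n (2 * K) r) (≤-trans (+-monoʳ-≤ r 2K∸r≤q) (≤-reflexive (+-comm r q)))

  max-K<r-q<2K∸r : K < r → r < suc (2 * K) → q < 2 * K ∸ r → paired K q r ⊔ staggered K q r ≡ 2 * K * (q + 1)
  max-K<r-q<2K∸r K<r r<M q<2K∸r = begin
    paired K q r ⊔ staggered K q r      ≡⟨ cong₂ _⊔_ (paired≡ (m≥n⇒m⊓n≡n (<⇒≤ K<r))) (staggered≡ (m≤n⇒m⊓n≡m (<⇒≤ r<M))) ⟩
    base + 2 * K ⊔ (base + (q + r))     ≡⟨ ⊔-left base q+r≤2K ⟩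
    base + 2 * K                         ≡⟨ regroup q K ⟩
    2 * K * (q + 1)                      ∎
    where
    open ≡-Reasoning
    regroup : ∀ q K → q * (2 * K) + 2 * K ≡ 2 * K * (q + 1)
    regroup = solve-∀
    q+r≤2K : q + r ≤ 2 * K
    q+r≤2K = ≤-trans (+-monoˡ-≤ r (<⇒≤ q<2K∸r)) (≤-reflexive (m∸n+n≡m (≤-pred r<M)))

  max-M≤r : suc (2 * K) ≤ r → paired K q r ⊔ staggered K q r ≡ suc (2 * K) * (q + 1)
  max-M≤r M≤r = begin
    paired K q r ⊔ staggered K q r          ≡⟨ cong₂ _⊔_ (paired≡ (m≥n⇒m⊓n≡n K≤r)) (staggered≡ (m≥n⇒m⊓n≡n M≤r)) ⟩
    base + 2 * K ⊔ (base + (q + suc (2 * K))) ≡⟨ ⊔-right base (≤-trans (n≤1+n (2 * K)) (m≤n+m _ q)) ⟩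
    base + (q + suc (2 * K))                 ≡⟨ regroup q K ⟩
    suc (2 * K) * (q + 1)                    ∎
    where
    open ≡-Reasoning
    K≤r = ≤-trans (m≤m+n K (K + 0)) (≤-trans (n≤1+n _) M≤r)
    regroup : ∀ q K → q * (2 * K) + (q + suc (2 * K)) ≡ suc (2 * K) * (q + 1)
    regroup = solve-∀

2*[2+K]∸4≡2*K : ∀ K → 2 * suc (suc K) ∸ 4 ≡ 2 * K
2*[2+K]∸4≡2*K K = cong (_∸ 4) (shift K)
  where
  shift : ∀ K → 2 * suc (suc K) ≡ 4 + 2 * K
  shift = solve-∀

2*[2+K]∸3≡1+2*K : ∀ K → 2 * suc (suc K) ∸ 3 ≡ suc (2 * K)
2*[2+K]∸3≡1+2*K K = cong (_∸ 3) (shift K)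
  where
  shift : ∀ K → 2 * suc (suc K) ≡ 3 + suc (2 * K)
  shift = solve-∀

theorem6p8 : (d k n : ℕ) → .{{_ : NonZero d}} → 4 ≤ k → k ∸ 1 ≤ d → 1 ≤ n →
    ((n ≤ d →
        (n ≤ 2 * k ∸ 4 → GpEq d k n (2 * (n ⊓ (k ∸ 2))))
        × (2 * k ∸ 3 ≤ n → GpEq d k n (2 * k ∸ 3)))
    × (suc d ≤ n → d < 2 * k ∸ 3 →
        GpEq d k n ((2 * k ∸ 4) * (n / d) + 2 * ((n % d) ⊓ (k ∸ 2))))
    × (suc d ≤ n → 2 * k ∸ 3 ≤ d →
        (n % d ≤ k ∸ 2 →
          (n % d ≤ n / d → GpEq d k n ((2 * k ∸ 3) * (n / d) + n % d))
          × (n / d < n % d → GpEq d k n ((2 * k ∸ 4) * (n / d) + 2 * (n % d))))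
        × (k ∸ 2 < n % d → n % d < 2 * k ∸ 3 →
          (2 * k ∸ 4 ∸ n % d ≤ n / d → GpEq d k n ((2 * k ∸ 3) * (n / d) + n % d))
          × (n / d < 2 * k ∸ 4 ∸ n % d → GpEq d k n ((2 * k ∸ 4) * (n / d + 1))))
        × (2 * k ∸ 3 ≤ n % d → GpEq d k n ((2 * k ∸ 3) * (n / d + 1)))))
theorem6p8 d (suc (suc K)) n (s≤s (s≤s _)) 1+K≤d _ rewrite 2*[2+K]∸4≡2*K K | 2*[2+K]∸3≡1+2*K K =
    (λ n≤d → gp-short-small d K n K≤d n≤d , gp-short-large d K n K≤d n≤d)
  , (λ _ d<M → gp-narrow d K n K≤d (≤-pred d<M))
  , λ _ M≤d → let gp = gp-wide d K n K≤d M≤d ; value = subst (GpEq d (suc (suc K)) n) in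
      (λ r≤K → (λ r≤q → value (max-r≤K-r≤q K q r r≤K r≤q) gp)
             , (λ q<r → value (max-r≤K-q<r K q r r≤K q<r) gp))
    , (λ K<r r<M → (λ 2K∸r≤q → value (max-K<r-2K∸r≤q K q r K<r r<M 2K∸r≤q) gp)
                 , (λ q<2K∸r → value (max-K<r-q<2K∸r K q r K<r r<M q<2K∸r) gp))
    , (λ M≤r → value (max-M≤r K q r M≤r) gp)
  where
  q = n / d
  r = n % d
  K≤d = <⇒≤ 1+K≤d
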